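{- Let $n\ge1$. The map $\Psi:S_n(132)\to\mathcal{D}_n$ defined below is a bijection, and for every $\sigma\in S_n(132)$: $\mathrm{fp}(\sigma)=\mathrm{ct}(\Psi(\sigma))$, $\mathrm{exc}(\sigma)=\mathrm{rt}(\Psi(\sigma))$, and $\mathrm{rk}(\sigma)=\tfrac12\bigl(n-\mathrm{he}(\Psi(\sigma))\bigr)$.
   Context: $S_n(132)$ is the set of permutations of $\{1,\dots,n\}$ with no indices $a<b<c$ such that $\sigma(a)<\sigma(c)<\sigma(b)$. $\mathrm{fp}(\sigma)=\#\{i:\sigma(i)=i\}$, $\mathrm{exc}(\sigma)=\#\{i:\sigma(i)>i\}$, and $\mathrm{rk}(\sigma)$ is the largest $k\ge0$ such that $\sigma(i)>k$ for all $i\le k$. A Dyck path of length $2n$ is a word $D$ in letters $u$ (up-step $(1,1)$) and $d$ (down-step $(1,-1)$) with $n$ of each, such that every prefix has at least as many $u$'s as $d$'s; $\mathcal{D}_n$ is the set of these. A tunnel of $D$ is a decomposition $D=AuBdC$ with $B$ a Dyck word (possibly empty). It is centered if $|A|=|C|$ and a right tunnel if $|A|>|C|$. $\mathrm{ct}(D)$, $\mathrm{rt}(D)$ are the numbers of centered and right tunnels; $\mathrm{he}(D)$ is (number of $u$) minus (number of $d$) among the first $n$ letters. Definition of $\Psi$: for $r=1,\dots,n$ let $w_r=\min_{i\le r}\sigma(i)-1$, and set $w_{n+1}=0$. Then $\Psi(\sigma)$ is the word obtained by concatenating, for $r=n,n-1,\dots,1$ in this order, the block $d^{\,w_r-w_{r+1}}u$,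 and finally appending $d^{\,n-w_1}$. (Geometrically: in the $n\times n$ array with a cross in row $i$, column $\sigma(i)$, shade each cross's cell and all cells due south and due east of it; $\Psi(\sigma)$ records the border of the unshaded region, read from the lower-left to the upper-right corner, with $u$ for each up-step and $d$ for each right-step.) -}

module Defs where

open import Data.Nat using (ℕ; zero; suc; _+_; _*_; _∸_; _⊓_; _≤_; _<_; _≤?_; _<?_)
import Data.Nat as ℕ
open import Data.Fin using (Fin; toℕ; fromℕ<)
import Data.Fin as F
import Data.Fin.Properties as FP
open import Data.Fin.Permutation using (Permutation′; _⟨$⟩ʳ_)
open import Data.List using (List; []; _∷_; _++_; [_]; length; replicate; take; map; concatMap; filter; inits; allFin)
open import Data.List.Relation.Unary.All using (All; all?)
open import Data.Product using (_×_; _,_; proj₁; proj₂; map₁)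
open import Relation.Binary.PropositionalEquality using (_≡_)
open import Relation.Nullary using (¬_; Dec; yes; no)
open import Relation.Nullary.Decidable using (_×-dec_; _→-dec_)
open import Data.Bool using (if_then_else_)
open import Relation.Nullary.Decidable using (does)

-- A permutation of {1,…,n} is a stdlib  Permutation′ n  (bijection Fin n ↔ Fin n);
-- positions and values are 0-based: position i (0-based) is position i+1 of the paper,
-- value v (0-based) is value v+1 of the paper.

_$_ : ∀ {n} → Permutation′ n → Fin n → Fin n
σ $ i = σ ⟨$⟩ʳ i

Avoids132 : ∀ {n} → Permutation′ n → Set
Avoids132 {n} σ = ∀ (a b c : Fin n) → a F.< b → b F.< c →
  ¬ ((σ $ a) F.< (σ $ c) × (σ $ c) F.< (σ $ b))

fp : ∀ {n} → Permutation′ n → ℕ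
fp {n} σ = length (filter (λ i → (σ $ i) FP.≟ i) (allFin n))

exc : ∀ {n} → Permutation′ n → ℕ
exc {n} σ = length (filter (λ i → i F.<? (σ $ i)) (allFin n))

-- rk(σ): largest k ≥ 0 with σ(i) > k for all i ≤ k (1-based).
-- In 0-based terms: for all positions i with toℕ i < k, k ≤ toℕ (σ i).
RkOk : ∀ {n} → Permutation′ n → ℕ → Set
RkOk {n} σ k = ∀ (i : Fin n) → toℕ i < k → k ≤ toℕ (σ $ i)

rkOk? : ∀ {n} (σ : Permutation′ n) (k : ℕ) → Dec (RkOk σ k)
rkOk? σ k = FP.all? (λ i → (toℕ i <? k) →-dec (k ≤? toℕ (σ $ i)))

rkFrom : ∀ {n} → Permutation′ n → ℕ → ℕ
rkFrom σ zero = zero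
rkFrom σ (suc k) = if does (rkOk? σ (suc k)) then suc k else rkFrom σ k

-- for n ≥ 1 no k > n is admissible, so the largest admissible k is found below n
rk : ∀ {n} → Permutation′ n → ℕ
rk {n} σ = rkFrom σ n

data Step : Set where
  u d : Step

numU : List Step → ℕ
numU [] = 0
numU (u ∷ w) = suc (numU w)
numU (d ∷ w) = numU w

numD : List Step → ℕ
numD [] = 0
numD (u ∷ w) = numD w
numD (d ∷ w) = suc (numD w)

IsDyckWord : List Step → Set
IsDyckWord w = numU w ≡ numD w × All (λ p → numD p ≤ numU p) (inits w)

isDyckWord? : (w : List Step) → Dec (IsDyckWord w)
isDyckWord? w = (numU w ℕ.≟ numD w) ×-dec all? (λ p → numD p ≤? numU p) (inits w)

IsDyckPath : ℕ → List Step → Set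
IsDyckPath n D = IsDyckWord D × numU D ≡ n

splits : {X : Set} → List X → List (List X × List X)
splits [] = [ ([] , []) ]
splits (x ∷ w) = ([] , x ∷ w) ∷ map (map₁ (x ∷_)) (splits w)

-- all decompositions D = A u B d C  (as triples (A , B , C)), B arbitrary
uBdSplits : List Step → List (List Step × List Step × List Step)
uBdSplits D = concatMap outer (splits D)
  where
  inner : List Step → List Step × List Step → List (List Step × List Step × List Step)
  inner A (B , d ∷ C) = [ (A , B , C) ]
  inner A (B , _) = []
  outer : List Step × List Step → List (List Step × List Step × List Step)
  outer (A , u ∷ R) = concatMap (inner A) (splits R)
  outer (A , _) = []

tunnels : List Step → List (List Step × List Step × List Step)
tunnels D = filter (λ t → isDyckWord? (proj₁ (proj₂ t))) (uBdSplits D)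

ct : List Step → ℕ
ct D = length (filter (λ t → length (proj₁ t) ℕ.≟ length (proj₂ (proj₂ t))) (tunnels D))

rt : List Step → ℕ
rt D = length (filter (λ t → length (proj₂ (proj₂ t)) <? length (proj₁ t)) (tunnels D))

-- he(D) for D of length 2n: (#u) − (#d) among the first n letters
-- (nonnegative for Dyck paths, so truncated subtraction is exact there)
he : ℕ → List Step → ℕ
he n D = numU (take n D) ∸ numD (take n D)

-- 0-based value at 0-based position r (i.e. σ(r+1) − 1 in the paper); n outside the range
val : ∀ {n} → Permutation′ n → ℕ → ℕ
val {n} σ r with r <? n
... | yes r<n = toℕ (σ $ fromℕ< r<n)
... | no _ = n

-- prefMin σ r = min_{i ≤ r} σ(i) − 1  (1-based r ≥ 1); prefMin σ 0 = n is the neutral start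
prefMin : ∀ {n} → Permutation′ n → ℕ → ℕ
prefMin {n} σ zero = n
prefMin σ (suc r) = prefMin σ r ⊓ val σ r

w : ∀ {n} → Permutation′ n → ℕ → ℕ
w {n} σ r = if does (r ℕ.≟ suc n) then 0 else prefMin σ r

blocks : ∀ {n} → Permutation′ n → ℕ → List Step
blocks σ zero = []
blocks σ (suc r) = (replicate (w σ (suc r) ∸ w σ (suc (suc r))) d ++ [ u ]) ++ blocks σ r

Ψ : ∀ {n} → Permutation′ n → List Step
Ψ {n} σ = blocks σ n ++ replicate (n ∸ w σ 1) d

{-# OPTIONS --safe #-}
-- If σ avoids 132 and has its maximum n-1 at position k,
-- every value before position k exceeds every value after it, so σ = (σₐ + m) (n-1) σᵦ
-- with m = n-1-k and σₐ, σᵦ again 132-avoiding; iterating turns σ into a binary tree,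
-- and every tree arises this way.  The prefix minima of σ are those of σₐ shifted by m up
-- to position k and then those of σᵦ, and Ψ reads them from the last position
-- backwards, so Ψ σ = Ψ σᵦ u Ψ σₐ d: the last-return decomposition of Dyck paths.  Parsing
-- a Dyck path with a stack of trees inverts it, so Ψ is a bijection.  Along the same
-- recursion, the tunnel whose u is contributed by position i has |A| - |C| = 2 (σ(i) - i),
-- so centred tunnels are fixed points and right tunnels are excedances.  Finally Ψ σ is
-- the staircase of the prefix minima w_r, and its first n letters stop in the horizontal
-- run of the row ρ where w_{ρ+1} ≤ ρ ≤ w_ρ, which is ρ = rk σ: they contain ρ letters d.
-- The first ρ values of σ lie in [ρ, n), so 2ρ ≤ n and the truncated subtractions in
-- he and (n - he) / 2 are exact.
module Submission where

open import Defs
open import Data.Bool using (true; false; if_then_else_)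
open import Data.Empty using (⊥-elim)
open import Data.Fin as F using (Fin; toℕ; fromℕ<; punchOut)
import Data.Fin.Properties as FP
open import Data.Fin.Permutation using (Permutation′; _⟨$⟩ʳ_; _⟨$⟩ˡ_; permutation; inverseˡ)
open import Data.List
  using (List; []; _∷_; _++_; [_]; length; inits; replicate; take; map; concatMap; filter; reverse;
         tabulate; allFin; applyUpTo; applyDownFrom)
open import Data.List.Properties
  using (++-assoc; ++-identityʳ; length-++; map-++; map-id; map-∘; map-cong; concatMap-map; concatMap-cong;
         map-concatMap; filter-++; filter-≐; filter-accept; filter-reject; filter-none; map-tabulate;
         tabulate-cong; reverse-applyUpTo)
open import Data.List.Relation.Binary.Permutation.Propositional.Properties using (↭-reverse; filter-↭; ↭-length)
open import Data.List.Relation.Unary.All as All using (All; []; _∷_)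
import Data.List.Relation.Unary.All.Properties as AllP
open import Data.Maybe using (Maybe; just; nothing)
open import Data.Maybe.Properties using (just-injective) renaming (≡-dec to ≡-dec-Maybe)
import Data.Nat as ℕ
open import Data.Nat using (ℕ; zero; suc; _+_; _*_; _∸_; _⊓_; _/_; _≤_; _<_; _≤?_; _<?_; z≤n; s≤s; s≤s⁻¹)
open import Data.Nat.DivMod using (m*n/n≡m)
open import Data.Nat.Induction using (<-rec)
open import Data.Nat.Properties
open import Data.Nat.Tactic.RingSolver using (solve-∀)
open import Data.Product using (_×_; _,_; proj₁; proj₂; ∃-syntax; map₁; map₂)
open import Data.Sum using (inj₁; inj₂; [_,_]′)
open import Function using (id; _∘_; _⇔_; mk⇔; Equivalence)
open import Relation.Binary.Definitions using (tri<; tri≈; tri>; DecidableEquality)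
open import Relation.Binary.PropositionalEquality hiding ([_])
open import Relation.Nullary using (¬_; Dec; yes; no; does)
open import Relation.Nullary.Decidable using (dec-true; dec-false)
open import Relation.Unary using (Decidable)

-- Sequences and lists

AgreeBelow : {X : Set} → ℕ → (ℕ → X) → (ℕ → X) → Set
AgreeBelow n g h = ∀ {i} → i < n → g i ≡ h i

filter-map : ∀ {A B : Set} {P : B → Set} (P? : Decidable P) (f : A → B) xs →
  filter P? (map f xs) ≡ map f (filter (P? ∘ f) xs)
filter-map P? f []       = refl
filter-map P? f (x ∷ xs) with does (P? (f x))
... | true  = cong (f x ∷_) (filter-map P? f xs)
... | false = filter-map P? f xs

map-∘-comm : ∀ {A B C D : Set} {f : A → B} {g : B → D} {f′ : A → C} {g′ : C → D} →
  (∀ x → g (f x) ≡ g′ (f′ x)) → ∀ xs → map g (map f xs) ≡ map g′ (map f′ xs)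
map-∘-comm g∘f≗g′∘f′ xs = trans (sym (map-∘ xs)) (trans (map-cong g∘f≗g′∘f′ xs) (map-∘ xs))

length-filter-map : ∀ {A B : Set} {P : A → Set} {Q : B → Set} (P? : Decidable P) (Q? : Decidable Q) (f : A → B) →
  (∀ x → P x ⇔ Q (f x)) → ∀ xs → length (filter P? xs) ≡ length (filter Q? (map f xs))
length-filter-map P? Q? f P⇔Q []       = refl
length-filter-map P? Q? f P⇔Q (x ∷ xs) with P? x | Q? (f x)
... | yes _  | yes _  = cong suc (length-filter-map P? Q? f P⇔Q xs)
... | no _   | no _   = length-filter-map P? Q? f P⇔Q xs
... | yes px | no ¬qx = ⊥-elim (¬qx (Equivalence.to (P⇔Q x) px))
... | no ¬px | yes qx = ⊥-elim (¬px (Equivalence.from (P⇔Q x) qx))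

take-++ : ∀ {A : Set} (xs : List A) k ys → take (length xs + k) (xs ++ ys) ≡ xs ++ take k ys
take-++ []       k ys = refl
take-++ (x ∷ xs) k ys = cong (x ∷_) (take-++ xs k ys)

take-replicate-++ : ∀ {A : Set} {j e} (x : A) ys → j ≤ e → take j (replicate e x ++ ys) ≡ replicate j x
take-replicate-++ x ys z≤n       = refl
take-replicate-++ x ys (s≤s j≤e) = cong (x ∷_) (take-replicate-++ x ys j≤e)

replicate-∷ʳ : ∀ {A : Set} e (x : A) → replicate (suc e) x ≡ replicate e x ++ [ x ]
replicate-∷ʳ zero    x = refl
replicate-∷ʳ (suc e) x = cong (x ∷_) (replicate-∷ʳ e x)

tabulate-toℕ : ∀ {X : Set} n (f : ℕ → X) → tabulate {n = n} (f ∘ toℕ) ≡ applyUpTo f n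
tabulate-toℕ zero    f = refl
tabulate-toℕ (suc n) f = cong (f 0 ∷_) (tabulate-toℕ n (f ∘ suc))

applyDownFrom-+ : ∀ {X : Set} (f : ℕ → X) m n → applyDownFrom f (m + n) ≡ applyDownFrom (λ i → f (i + n)) m ++ applyDownFrom f n
applyDownFrom-+ f zero    n = refl
applyDownFrom-+ f (suc m) n = cong (f (m + n) ∷_) (applyDownFrom-+ f m n)

applyDownFrom-cong : ∀ {X : Set} {f g : ℕ → X} n → AgreeBelow n f g → applyDownFrom f n ≡ applyDownFrom g n
applyDownFrom-cong zero    _     = refl
applyDownFrom-cong (suc n) agree = cong₂ _∷_ (agree ≤-refl) (applyDownFrom-cong n (agree ∘ m<n⇒m<1+n))

applyDownFrom-split : ∀ {X : Set} (f : ℕ → X) k m →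
  applyDownFrom f (suc (k + m)) ≡ applyDownFrom (λ j → f (suc (k + j))) m ++ f k ∷ applyDownFrom f k
applyDownFrom-split f k m = begin
  applyDownFrom f (suc (k + m))                              ≡⟨ cong (applyDownFrom f) (trans (cong suc (+-comm k m)) (sym (+-suc m k))) ⟩
  applyDownFrom f (m + suc k)                                ≡⟨ applyDownFrom-+ f m (suc k) ⟩
  applyDownFrom (λ j → f (j + suc k)) m ++ applyDownFrom f (suc k)
    ≡⟨ cong (_++ applyDownFrom f (suc k)) (applyDownFrom-cong m (λ {j} _ → cong f (trans (+-suc j k) (cong suc (+-comm j k))))) ⟩
  applyDownFrom (λ j → f (suc (k + j))) m ++ f k ∷ applyDownFrom f k ∎
  where open ≡-Reasoning

-- Dyck words and heights

numU-++ : ∀ xs ys → numU (xs ++ ys) ≡ numU xs + numU ys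
numU-++ []       ys = refl
numU-++ (u ∷ xs) ys = cong suc (numU-++ xs ys)
numU-++ (d ∷ xs) ys = numU-++ xs ys

numD-++ : ∀ xs ys → numD (xs ++ ys) ≡ numD xs + numD ys
numD-++ []       ys = refl
numD-++ (u ∷ xs) ys = numD-++ xs ys
numD-++ (d ∷ xs) ys = cong suc (numD-++ xs ys)

length≡numU+numD : ∀ w → length w ≡ numU w + numD w
length≡numU+numD []      = refl
length≡numU+numD (u ∷ w) = cong suc (length≡numU+numD w)
length≡numU+numD (d ∷ w) = trans (cong suc (length≡numU+numD w)) (sym (+-suc (numU w) (numD w)))

numU-replicate-d : ∀ e → numU (replicate e d) ≡ 0
numU-replicate-d zero    = refl
numU-replicate-d (suc e) = numU-replicate-d e

numD-replicate-d : ∀ e → numD (replicate e d) ≡ e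
numD-replicate-d zero    = refl
numD-replicate-d (suc e) = cong suc (numD-replicate-d e)

height : ℕ → List Step → Maybe ℕ
height h       []      = just h
height h       (u ∷ w) = height (suc h) w
height zero    (d ∷ w) = nothing
height (suc h) (d ∷ w) = height h w

height≡just⇒ : ∀ w h {h′} → height h w ≡ just h′ →
  h + numU w ≡ numD w + h′ × All (λ p → numD p ≤ h + numU p) (inits w)
height≡just⇒ []      h       refl = +-identityʳ h , z≤n ∷ []
height≡just⇒ (u ∷ w) h       e    with height≡just⇒ w (suc h) e
... | balanced , prefixes =
  trans (+-suc h (numU w)) balanced ,
  z≤n ∷ AllP.map⁺ (All.map (λ {p} le → ≤-trans le (≤-reflexive (sym (+-suc h (numU p))))) prefixes)
height≡just⇒ (d ∷ w) (suc h) e    with height≡just⇒ w h e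
... | balanced , prefixes = cong suc balanced , z≤n ∷ AllP.map⁺ (All.map s≤s prefixes)

height≡just⇐ : ∀ w h → All (λ p → numD p ≤ h + numU p) (inits w) → height h w ≡ just (h + numU w ∸ numD w)
height≡just⇐ []      h       _                = cong just (sym (+-identityʳ h))
height≡just⇐ (u ∷ w) h       (_ ∷ prefixes)   = trans
  (height≡just⇐ w (suc h) (All.map (λ {p} le → ≤-trans le (≤-reflexive (+-suc h (numU p)))) (AllP.map⁻ prefixes)))
  (cong (λ z → just (z ∸ numD w)) (sym (+-suc h (numU w))))
height≡just⇐ (d ∷ w) zero    (_ ∷ () ∷ _)
height≡just⇐ (d ∷ w) (suc h) (_ ∷ prefixes)   = height≡just⇐ w h (All.map s≤s⁻¹ (AllP.map⁻ prefixes))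

isDyckWord⇔height : ∀ w → IsDyckWord w ⇔ height 0 w ≡ just 0
isDyckWord⇔height w = mk⇔ to from
  where
  to : IsDyckWord w → height 0 w ≡ just 0
  to (balanced , prefixes) = trans (height≡just⇐ w 0 prefixes) (cong just (trans (cong (_∸ numD w) balanced) (n∸n≡0 (numD w))))
  from : height 0 w ≡ just 0 → IsDyckWord w
  from e with height≡just⇒ w 0 e
  ... | balanced , prefixes = trans balanced (+-identityʳ (numD w)) , prefixes

-- Binary trees and their Dyck words

data Tree : Set where
  leaf : Tree
  node : Tree → Tree → Tree

size : Tree → ℕ
size leaf       = 0
size (node a b) = suc (size a + size b)

word : Tree → List Step
word leaf       = []
word (node a b) = word b ++ u ∷ word a ++ [ d ]

word-++ : ∀ a b Y → word (node a b) ++ Y ≡ word b ++ u ∷ word a ++ d ∷ Y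
word-++ a b Y = trans (++-assoc (word b) _ Y) (cong (λ z → word b ++ u ∷ z) (++-assoc (word a) [ d ] Y))

numU-word : ∀ t → numU (word t) ≡ size t
numU-word leaf       = refl
numU-word (node a b) = begin
  numU (word b ++ u ∷ word a ++ [ d ])    ≡⟨ numU-++ (word b) _ ⟩
  numU (word b) + suc (numU (word a ++ [ d ])) ≡⟨ cong (λ z → numU (word b) + suc z) (trans (numU-++ (word a) [ d ]) (+-identityʳ _)) ⟩
  numU (word b) + suc (numU (word a))     ≡⟨ cong₂ (λ x y → x + suc y) (numU-word b) (numU-word a) ⟩
  size b + suc (size a)                   ≡⟨ trans (+-suc (size b) (size a)) (cong suc (+-comm (size b) (size a))) ⟩
  suc (size a + size b)                   ∎
  where open ≡-Reasoning

length-word : ∀ t → length (word t) ≡ 2 * size t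
length-word leaf       = refl
length-word (node a b) = begin
  length (word b ++ u ∷ word a ++ [ d ])       ≡⟨ length-++ (word b) ⟩
  length (word b) + suc (length (word a ++ [ d ])) ≡⟨ cong (λ x → length (word b) + suc x) (length-++ (word a)) ⟩
  length (word b) + suc (length (word a) + 1)  ≡⟨ cong₂ (λ x y → x + suc (y + 1)) (length-word b) (length-word a) ⟩
  2 * size b + suc (2 * size a + 1)            ≡⟨ arith (size a) (size b) ⟩
  2 * suc (size a + size b)                    ∎
  where
  open ≡-Reasoning
  arith : ∀ k m → 2 * m + suc (2 * k + 1) ≡ 2 * suc (k + m)
  arith = solve-∀

height-word-++ : ∀ t h Y → height h (word t ++ Y) ≡ height h Y
height-word-++ leaf       h Y = refl
height-word-++ (node a b) h Y rewrite word-++ a b Y | height-word-++ b h (u ∷ word a ++ d ∷ Y) | height-word-++ a (suc h) (d ∷ Y) = refl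

height-word : ∀ t → height 0 (word t) ≡ just 0
height-word t = trans (cong (height 0) (sym (++-identityʳ (word t)))) (height-word-++ t 0 [])

word-isDyckPath : ∀ t → IsDyckPath (size t) (word t)
word-isDyckPath t = Equivalence.from (isDyckWord⇔height (word t)) (height-word t) , numU-word t

-- The whole input, reconstructed from a parser state: stack S, current tree t, unread w.
unparse : List Tree → Tree → List Step → List Step
unparse []      t w = word t ++ w
unparse (s ∷ S) t w = unparse S s (u ∷ word t ++ w)

unparse-cong : ∀ S {s s′ w w′} → word s ++ w ≡ word s′ ++ w′ → unparse S s w ≡ unparse S s′ w′
unparse-cong []      e = e
unparse-cong (r ∷ S) e = cong (λ z → unparse S r (u ∷ z)) e

parse : ∀ S t w → height (length S) w ≡ just 0 → ∃[ t₀ ] unparse S t w ≡ word t₀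
parse S       t (u ∷ w) h = parse (t ∷ S) leaf w h
parse []      t []      _ = t , ++-identityʳ (word t)
parse (s ∷ S) t []      ()
parse []      t (d ∷ w) ()
parse (s ∷ S) t (d ∷ w) h with parse S (node t s) w h
... | t₀ , e = t₀ , trans (unparse-cong S (sym (word-++ t s w))) e

word-surjective : ∀ {n D} → IsDyckPath n D → ∃[ t ] (size t ≡ n × word t ≡ D)
word-surjective {n} {D} (dyck , numU≡n) with parse [] leaf D (Equivalence.to (isDyckWord⇔height D) dyck)
... | t , D≡word = t , trans (sym (numU-word t)) (trans (cong numU (sym D≡word)) numU≡n) , sym D≡word

run : List Tree → Tree → List Step → Maybe Tree
run S       t (u ∷ w) = run (t ∷ S) leaf w
run []      t []      = just t
run (_ ∷ _) _ []      = nothing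
run []      _ (d ∷ _) = nothing
run (s ∷ S) t (d ∷ w) = run S (node t s) w

graft : Tree → Tree → Tree
graft s leaf       = s
graft s (node a b) = node a (graft s b)

graft-leaf : ∀ t → graft leaf t ≡ t
graft-leaf leaf       = refl
graft-leaf (node a b) = cong (node a) (graft-leaf b)

run-word-++ : ∀ t s S w → run S s (word t ++ w) ≡ run S (graft s t) w
run-word-++ leaf       s S w = refl
run-word-++ (node a b) s S w rewrite word-++ a b w | run-word-++ b s S (u ∷ word a ++ d ∷ w)
  | run-word-++ a leaf (graft s b ∷ S) (d ∷ w) | graft-leaf a = refl

word-injective : ∀ {t t′} → word t ≡ word t′ → t ≡ t′
word-injective {t} {t′} e = just-injective (begin
  just t                          ≡⟨ cong just (sym (graft-leaf t)) ⟩
  just (graft leaf t)             ≡⟨ sym (run-word-++ t leaf [] []) ⟩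
  run [] leaf (word t ++ [])      ≡⟨ cong (λ w → run [] leaf (w ++ [])) e ⟩
  run [] leaf (word t′ ++ [])     ≡⟨ run-word-++ t′ leaf [] [] ⟩
  just (graft leaf t′)            ≡⟨ cong just (graft-leaf t′) ⟩
  just t′                         ∎)
  where open ≡-Reasoning

-- 132-avoiding permutations as binary trees

record Perm132 (n : ℕ) (g : ℕ → ℕ) : Set where
  field
    bounded   : ∀ {i} → i < n → g i < n
    injective : ∀ {i j} → i < n → j < n → g i ≡ g j → i ≡ j
    avoids    : ∀ {a b c} → a < b → b < c → c < n → ¬ (g a < g c × g c < g b)

perm : Tree → ℕ → ℕ
perm leaf       _ = 0
perm (node a b) i with <-cmp i (size a)
... | tri< _ _ _ = perm a i + size b
... | tri≈ _ _ _ = size a + size b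
... | tri> _ _ _ = perm b (i ∸ suc (size a))

perm-left : ∀ a b {i} → i < size a → perm (node a b) i ≡ perm a i + size b
perm-left a b {i} i<k with <-cmp i (size a)
... | tri< _ _ _    = refl
... | tri≈ ¬i<k _ _ = ⊥-elim (¬i<k i<k)
... | tri> ¬i<k _ _ = ⊥-elim (¬i<k i<k)

perm-root : ∀ a b → perm (node a b) (size a) ≡ size a + size b
perm-root a b with <-cmp (size a) (size a)
... | tri< _ k≢k _ = ⊥-elim (k≢k refl)
... | tri≈ _ _ _   = refl
... | tri> _ k≢k _ = ⊥-elim (k≢k refl)

perm-right : ∀ a b j → perm (node a b) (suc (size a + j)) ≡ perm b j
perm-right a b j with <-cmp (suc (size a + j)) (size a)
... | tri< i<k _ _ = ⊥-elim (<-asym i<k (s≤s (m≤m+n (size a) j)))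
... | tri≈ _ i≡k _ = ⊥-elim (<-irrefl (sym i≡k) (s≤s (m≤m+n (size a) j)))
... | tri> _ _ _   = cong (perm b) (m+n∸m≡n (size a) j)

data Part (k m : ℕ) : ℕ → Set where
  left  : ∀ {i} → i < k → Part k m i
  root  : Part k m k
  right : ∀ {j} → j < m → Part k m (suc (k + j))

part : ∀ {k m i} → i < suc (k + m) → Part k m i
part {k} {m} {i} i<n with <-cmp i k
... | tri< i<k _ _  = left i<k
... | tri≈ _ refl _ = root
... | tri> _ _ k<i  = subst (Part k m) (m+[n∸m]≡n k<i)
  (right (+-cancelˡ-< (suc k) _ _ (subst (_< suc (k + m)) (sym (m+[n∸m]≡n k<i)) i<n)))

perm-bounded : ∀ t {i} → i < size t → perm t i < size t
perm-bounded (node a b) i<n with part {size a} {size b} i<n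
... | left i<k  = subst (_< suc (size a + size b)) (sym (perm-left a b i<k))
                    (m≤n⇒m≤1+n (+-monoˡ-< (size b) (perm-bounded a i<k)))
... | root      = subst (_< suc (size a + size b)) (sym (perm-root a b)) ≤-refl
... | right j<m = subst (_< suc (size a + size b)) (sym (perm-right a b _))
                    (m≤n⇒m≤1+n (≤-trans (perm-bounded b j<m) (m≤n+m (size b) (size a))))

module NodeValues (a b : Tree) where
  private
    k = size a
    m = size b
    g = perm (node a b)

    m≤left : ∀ {i} → i < k → m ≤ g i
    m≤left {i} i<k = subst (m ≤_) (sym (perm-left a b i<k)) (m≤n+m m (perm a i))

    right<m : ∀ {j} → j < m → g (suc (k + j)) < m
    right<m {j} j<m = subst (_< m) (sym (perm-right a b j)) (perm-bounded b j<m)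

  right<left : ∀ {i j} → i < k → j < m → g (suc (k + j)) < g i
  right<left i<k j<m = <-≤-trans (right<m j<m) (m≤left i<k)

  right<root : ∀ {j} → j < m → g (suc (k + j)) < g k
  right<root j<m = <-≤-trans (right<m j<m) (≤-trans (m≤n+m m k) (≤-reflexive (sym (perm-root a b))))

  left<root : ∀ {i} → i < k → g i < g k
  left<root {i} i<k = subst₂ _<_ (sym (perm-left a b i<k)) (sym (perm-root a b)) (+-monoˡ-< m (perm-bounded a i<k))

perm-injective : ∀ t {i j} → i < size t → j < size t → perm t i ≡ perm t j → i ≡ j
perm-injective (node a b) i<n j<n e with part {size a} {size b} i<n | part {size a} {size b} j<n
... | left i<k  | left j<k  = perm-injective a i<k j<k
  (+-cancelʳ-≡ _ _ _ (trans (sym (perm-left a b i<k)) (trans e (perm-left a b j<k))))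
... | root      | root      = refl
... | right i<m | right j<m = cong (λ x → suc (size a + x)) (perm-injective b i<m j<m
  (trans (sym (perm-right a b _)) (trans e (perm-right a b _))))
... | left i<k  | root      = ⊥-elim (<-irrefl e (NodeValues.left<root a b i<k))
... | root      | left j<k  = ⊥-elim (<-irrefl (sym e) (NodeValues.left<root a b j<k))
... | left i<k  | right j<m = ⊥-elim (<-irrefl (sym e) (NodeValues.right<left a b i<k j<m))
... | right i<m | left j<k  = ⊥-elim (<-irrefl e (NodeValues.right<left a b j<k i<m))
... | root      | right j<m = ⊥-elim (<-irrefl (sym e) (NodeValues.right<root a b j<m))
... | right i<m | root      = ⊥-elim (<-irrefl e (NodeValues.right<root a b i<m))

perm-avoids : ∀ t {x y z} → x < y → y < z → z < size t → ¬ (perm t x < perm t z × perm t z < perm t y)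
perm-avoids (node a b) {y = y} x<y y<z z<n (gx<gz , gz<gy) with part {size a} {size b} z<n
... | left z<k = perm-avoids a x<y y<z z<k
  (+-cancelʳ-< _ _ _ (subst₂ _<_ (perm-left a b x<k) (perm-left a b z<k) gx<gz) ,
   +-cancelʳ-< _ _ _ (subst₂ _<_ (perm-left a b z<k) (perm-left a b y<k) gz<gy))
  where
  y<k = <-trans y<z z<k
  x<k = <-trans x<y y<k
... | root = <⇒≱ gz<gy (subst (perm (node a b) y ≤_) (sym (perm-root a b))
  (s≤s⁻¹ (perm-bounded (node a b) (<-trans y<z z<n))))
... | right jz<m with part {size a} {size b} (<-trans x<y (<-trans y<z z<n))
...   | left x<k = <-asym gx<gz (NodeValues.right<left a b x<k jz<m)
...   | root     = <-asym gx<gz (NodeValues.right<root a b jz<m)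
...   | right {jx} jx<m with part {size a} {size b} (<-trans y<z z<n)
...     | left y<k = <-asym x<y (<-trans y<k (s≤s (m≤m+n (size a) jx)))
...     | root     = <-asym x<y (s≤s (m≤m+n (size a) jx))
...     | right jy<m = perm-avoids b
  (+-cancelˡ-< (size a) _ _ (s≤s⁻¹ x<y)) (+-cancelˡ-< (size a) _ _ (s≤s⁻¹ y<z)) jz<m
  (subst₂ _<_ (perm-right a b _) (perm-right a b _) gx<gz , subst₂ _<_ (perm-right a b _) (perm-right a b _) gz<gy)

perm-perm132 : ∀ t → Perm132 (size t) (perm t)
perm-perm132 t = record
  { bounded   = perm-bounded t
  ; injective = perm-injective t
  ; avoids    = perm-avoids t
  }

injective⇒≤∸ : ∀ {p lo hi} (h : ℕ → ℕ) → (∀ {i} → i < p → lo ≤ h i × h i < hi) →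
  (∀ {i j} → i < p → j < p → h i ≡ h j → i ≡ j) → p ≤ hi ∸ lo
injective⇒≤∸ {p} {lo} {hi} h range inj = FP.injective⇒≤ {f = shifted} shifted-injective
  where
  shifted : Fin p → Fin (hi ∸ lo)
  shifted x = fromℕ< (∸-monoˡ-< (proj₂ (range (FP.toℕ<n x))) (proj₁ (range (FP.toℕ<n x))))
  shifted-injective : ∀ {x y} → shifted x ≡ shifted y → x ≡ y
  shifted-injective {x} {y} e = FP.toℕ-injective (inj (FP.toℕ<n x) (FP.toℕ<n y)
    (∸-cancelʳ-≡ (proj₁ (range (FP.toℕ<n x))) (proj₁ (range (FP.toℕ<n y)))
      (trans (sym (FP.toℕ-fromℕ< _)) (trans (cong toℕ e) (FP.toℕ-fromℕ< _)))))

argmax : ∀ (g : ℕ → ℕ) n → ∃[ k ] (k < suc n × ∀ {i} → i < suc n → g i ≤ g k)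
argmax g zero = 0 , s≤s z≤n , λ { (s≤s z≤n) → ≤-refl }
argmax g (suc n) with argmax g n
... | k , k≤n , k-max with g (suc n) ≤? g k
...   | yes last≤ = k , m<n⇒m<1+n k≤n , λ i≤ →
  [ k-max , (λ { refl → last≤ }) ]′ (m≤n⇒m<n∨m≡n (s≤s⁻¹ i≤))
...   | no  last≰ = suc n , ≤-refl , λ i≤ →
  [ (λ i≤n → ≤-trans (k-max i≤n) (<⇒≤ (≰⇒> last≰))) , (λ { refl → ≤-refl }) ]′ (m≤n⇒m<n∨m≡n (s≤s⁻¹ i≤))

argmax-top : ∀ {n g} → Perm132 (suc n) g → ∀ {k} → k < suc n → (∀ {i} → i < suc n → g i ≤ g k) → g k ≡ n
argmax-top {n} {g} π {k} k≤n k-max = ≤-antisym (s≤s⁻¹ (bounded k≤n))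
  (s≤s⁻¹ (injective⇒≤∸ g (λ i≤n → z≤n , s≤s (k-max i≤n)) injective))
  where open Perm132 π

module AroundMaximum {n g} (π : Perm132 (suc n) g) {k} (k≤n : k < suc n) (g-top : g k ≡ n) where
  open Perm132 π

  m : ℕ
  m = n ∸ k

  k+m≡n : k + m ≡ n
  k+m≡n = m+[n∸m]≡n (s≤s⁻¹ k≤n)

  right-position : ∀ {j} → j < m → suc (k + j) < suc n
  right-position j<m = s≤s (subst (_ <_) k+m≡n (+-monoʳ-< k j<m))

  below-top : ∀ {i} → i < suc n → i ≢ k → g i < n
  below-top i≤n i≢k = ≤∧≢⇒< (s≤s⁻¹ (bounded i≤n)) (λ e → i≢k (injective i≤n k≤n (trans e (sym g-top))))

  right<left : ∀ {i j} → i < k → k < j → j < suc n → g j < g i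
  right<left {i} {j} i<k k<j j≤n with <-cmp (g i) (g j)
  ... | tri< gi<gj _ _ = ⊥-elim (avoids i<k k<j j≤n
    (gi<gj , subst (g j <_) (sym g-top) (below-top j≤n (λ { refl → <-irrefl refl k<j }))))
  ... | tri≈ _ gi≡gj _ = ⊥-elim (<-irrefl (injective (<-trans i<k k≤n) j≤n gi≡gj) (<-trans i<k k<j))
  ... | tri> _ _ gj<gi = gj<gi

  -- The m values to the right of the maximum are distinct and all below g i.
  -- The m values to the right of the maximum are distinct and all below g i.
  m≤left : ∀ {i} → i < k → m ≤ g i
  m≤left i<k = injective⇒≤∸ (λ j → g (suc (k + j)))
    (λ j<m → z≤n , right<left i<k (s≤s (m≤m+n k _)) (right-position j<m))
    (λ j<m j′<m e → +-cancelˡ-≡ k _ _ (suc-injective (injective (right-position j<m) (right-position j′<m) e)))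

  -- g j is below the k values to the left of the maximum and below the maximum itself.
  -- g j is below the k values to the left of the maximum and below the maximum itself.
  right<m : ∀ {j} → k < j → j < suc n → g j < m
  right<m {j} k<j j≤n = m+n≤o⇒m≤o∸n (suc (g j))
    (subst (_≤ n) (cong suc (+-comm k (g j))) (m≤o∸n⇒m+n≤o (suc k) gj≤n above-gj))
    where
    gj≤n : g j ≤ n
    gj≤n = s≤s⁻¹ (bounded j≤n)
    above-gj : suc k ≤ n ∸ g j
    above-gj = injective⇒≤∸ g
      (λ i≤k → [ (λ i<k → right<left i<k k<j j≤n) , (λ { refl → subst (g j <_) (sym g-top)
                   (below-top j≤n (λ { refl → <-irrefl refl k<j })) }) ]′ (m≤n⇒m<n∨m≡n (s≤s⁻¹ i≤k))
                , bounded (≤-trans i≤k k≤n))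
      (λ i≤k i′≤k → injective (≤-trans i≤k k≤n) (≤-trans i′≤k k≤n))

  left-part : Perm132 k (λ i → g i ∸ m)
  left-part = record
    { bounded   = λ {i} i<k → subst (g i ∸ m <_) (m∸[m∸n]≡n (s≤s⁻¹ k≤n))
                    (∸-monoˡ-< (below-top (<-trans i<k k≤n) (λ { refl → <-irrefl refl i<k })) (m≤left i<k))
    ; injective = λ i<k j<k e → injective (<-trans i<k k≤n) (<-trans j<k k≤n) (∸-cancelʳ-≡ (m≤left i<k) (m≤left j<k) e)
    ; avoids    = λ a<b b<c c<k (lt₁ , lt₂) → avoids a<b b<c (<-trans c<k k≤n)
                    (∸-cancelʳ-<′ (m≤left (<-trans a<b (<-trans b<c c<k))) (m≤left c<k) lt₁ ,
                     ∸-cancelʳ-<′ (m≤left c<k) (m≤left (<-trans b<c c<k)) lt₂)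
    }
    where
    ∸-cancelʳ-<′ : ∀ {x y} → m ≤ x → m ≤ y → x ∸ m < y ∸ m → x < y
    ∸-cancelʳ-<′ m≤x m≤y lt = subst₂ _<_ (m∸n+n≡m m≤x) (m∸n+n≡m m≤y) (+-monoˡ-< m lt)

  right-part : Perm132 m (λ j → g (suc (k + j)))
  right-part = record
    { bounded   = λ j<m → right<m (s≤s (m≤m+n k _)) (right-position j<m)
    ; injective = λ i<m j<m e → +-cancelˡ-≡ k _ _ (suc-injective (injective (right-position i<m) (right-position j<m) e))
    ; avoids    = λ a<b b<c c<m → avoids (s≤s (+-monoʳ-< k a<b)) (s≤s (+-monoʳ-< k b<c)) (right-position c<m)
    }

  left-value : ∀ {i} → i < k → g i ≡ (g i ∸ m) + m
  left-value i<k = sym (m∸n+n≡m (m≤left i<k))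

  root-value : g k ≡ k + m
  root-value = trans g-top (sym k+m≡n)

node-agrees : ∀ {g k m} ta tb → size ta ≡ k → size tb ≡ m →
  (∀ {i} → i < k → g i ≡ perm ta i + m) → g k ≡ k + m → (∀ {j} → j < m → g (suc (k + j)) ≡ perm tb j) →
  AgreeBelow (suc (k + m)) g (perm (node ta tb))
node-agrees ta tb refl refl left-values root-value right-values i<n with part i<n
... | left i<k  = trans (left-values i<k) (sym (perm-left ta tb i<k))
... | root      = trans root-value (sym (perm-root ta tb))
... | right j<m = trans (right-values j<m) (sym (perm-right ta tb _))

decompose : ∀ {n g} → Perm132 n g → ∃[ t ] (size t ≡ n × AgreeBelow n g (perm t))
decompose {n} {g} = <-rec P step n g
  where
  P : ℕ → Set
  P n = ∀ g → Perm132 n g → ∃[ t ] (size t ≡ n × AgreeBelow n g (perm t))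
  step : ∀ n → (∀ {n′} → n′ < n → P n′) → P n
  step zero    _   g _ = leaf , refl , λ ()
  step (suc n) rec g π =
    let k , k≤n , k-max = argmax g n
        open AroundMaximum π k≤n (argmax-top π k≤n k-max)
        ta , |ta| , agree-a = rec k≤n _ left-part
        tb , |tb| , agree-b = rec (s≤s (m∸n≤m n k)) _ right-part
    in node ta tb , cong suc (trans (cong₂ _+_ |ta| |tb|) k+m≡n) ,
       subst (λ x → AgreeBelow (suc x) g (perm (node ta tb))) k+m≡n
         (node-agrees ta tb |ta| |tb| (λ i<k → trans (left-value i<k) (cong (_+ m) (agree-a i<k))) root-value agree-b)

-- Permutations of Fin n as sequences

val-toℕ : ∀ {n} (σ : Permutation′ n) i → val σ (toℕ i) ≡ toℕ (σ ⟨$⟩ʳ i)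
val-toℕ {n} σ i with toℕ i <? n
... | yes i<n = cong (λ j → toℕ (σ ⟨$⟩ʳ j)) (FP.fromℕ<-toℕ i i<n)
... | no  i≮n = ⊥-elim (i≮n (FP.toℕ<n i))

val-fromℕ< : ∀ {n} (σ : Permutation′ n) {i} (i<n : i < n) → val σ i ≡ toℕ (σ ⟨$⟩ʳ fromℕ< i<n)
val-fromℕ< σ i<n = trans (cong (val σ) (sym (FP.toℕ-fromℕ< i<n))) (val-toℕ σ (fromℕ< i<n))

val-bounded : ∀ {n} (σ : Permutation′ n) {i} → i < n → val σ i < n
val-bounded {n} σ i<n = subst (_< n) (sym (val-fromℕ< σ i<n)) (FP.toℕ<n _)

val-injective : ∀ {n} (σ : Permutation′ n) {i j} → i < n → j < n → val σ i ≡ val σ j → i ≡ j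
val-injective σ i<n j<n e = trans (sym (FP.toℕ-fromℕ< i<n)) (trans (cong toℕ (σ-injective
  (FP.toℕ-injective (trans (sym (val-fromℕ< σ i<n)) (trans e (val-fromℕ< σ j<n)))))) (FP.toℕ-fromℕ< j<n))
  where
  σ-injective : ∀ {x y} → σ ⟨$⟩ʳ x ≡ σ ⟨$⟩ʳ y → x ≡ y
  σ-injective {x} {y} e = trans (sym (inverseˡ σ)) (trans (cong (σ ⟨$⟩ˡ_) e) (inverseˡ σ))

avoids132⇒perm132 : ∀ {n} (σ : Permutation′ n) → Avoids132 σ → Perm132 n (val σ)
avoids132⇒perm132 {n} σ av = record
  { bounded   = val-bounded σ
  ; injective = val-injective σ
  ; avoids    = λ {a} {b} {c} a<b b<c c<n (lt₁ , lt₂) →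
      let b<n = <-trans b<c c<n ; a<n = <-trans a<b b<n in
      av (fromℕ< a<n) (fromℕ< b<n) (fromℕ< c<n)
        (subst₂ _<_ (sym (FP.toℕ-fromℕ< a<n)) (sym (FP.toℕ-fromℕ< b<n)) a<b)
        (subst₂ _<_ (sym (FP.toℕ-fromℕ< b<n)) (sym (FP.toℕ-fromℕ< c<n)) b<c)
        (subst₂ _<_ (val-fromℕ< σ a<n) (val-fromℕ< σ c<n) lt₁ , subst₂ _<_ (val-fromℕ< σ c<n) (val-fromℕ< σ b<n) lt₂)
  }

injective⇒surjective : ∀ {n} {f : Fin n → Fin n} → (∀ {x y} → f x ≡ f y → x ≡ y) → ∀ y → ∃[ x ] f x ≡ y
injective⇒surjective {suc n} {f} inj y with FP.any? (λ x → f x FP.≟ y)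
... | yes hit  = hit
... | no  miss = ⊥-elim (<-irrefl refl (FP.injective⇒≤ {f = avoiding-y} (λ e → inj (FP.punchOut-injective (y≢f _) (y≢f _) e))))
  where
  y≢f : ∀ x → y ≢ f x
  y≢f x e = miss (x , sym e)
  avoiding-y : Fin (suc n) → Fin n
  avoiding-y x = punchOut (y≢f x)

injection⇒permutation : ∀ {n} (f : Fin n → Fin n) → (∀ {x y} → f x ≡ f y → x ≡ y) → Permutation′ n
injection⇒permutation f inj = permutation f (proj₁ ∘ injective⇒surjective inj)
  (proj₂ ∘ injective⇒surjective inj) (λ x → inj (proj₂ (injective⇒surjective inj (f x))))

perm132⇒permutation : ∀ {n g} → Perm132 n g → ∃[ σ ] (Avoids132 {n} σ × AgreeBelow n (val σ) g)
perm132⇒permutation {n} {g} π = σ , σ-avoids , λ i<n → trans (val-fromℕ< σ i<n) (trans (toℕ-f _) (cong g (FP.toℕ-fromℕ< i<n)))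
  where
  open Perm132 π
  f : Fin n → Fin n
  f i = fromℕ< (bounded (FP.toℕ<n i))
  toℕ-f : ∀ i → toℕ (f i) ≡ g (toℕ i)
  toℕ-f i = FP.toℕ-fromℕ< _
  σ : Permutation′ n
  σ = injection⇒permutation f λ {i} {j} e → FP.toℕ-injective
    (injective (FP.toℕ<n i) (FP.toℕ<n j) (trans (sym (toℕ-f i)) (trans (cong toℕ e) (toℕ-f j))))
  σ-avoids : Avoids132 σ
  σ-avoids a b c a<b b<c (lt₁ , lt₂) = avoids a<b b<c (FP.toℕ<n c)
    (subst₂ _<_ (toℕ-f a) (toℕ-f c) lt₁ , subst₂ _<_ (toℕ-f c) (toℕ-f b) lt₂)

-- The staircase word of a sequence of prefix minima

prefixMin : ℕ → (ℕ → ℕ) → ℕ → ℕ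
prefixMin s g zero    = s
prefixMin s g (suc r) = prefixMin s g r ⊓ g r

prefixMin-cong : ∀ {s g h} r → AgreeBelow r g h → prefixMin s g r ≡ prefixMin s h r
prefixMin-cong zero    _     = refl
prefixMin-cong (suc r) agree = cong₂ _⊓_ (prefixMin-cong r (agree ∘ m<n⇒m<1+n)) (agree ≤-refl)

prefixMin-+ : ∀ {s g} q r → prefixMin s g (q + r) ≡ prefixMin (prefixMin s g r) (λ i → g (i + r)) q
prefixMin-+ zero    r = refl
prefixMin-+ (suc q) r = cong (_⊓ _) (prefixMin-+ q r)

prefixMin≤start : ∀ {s g} r → prefixMin s g r ≤ s
prefixMin≤start zero    = ≤-refl
prefixMin≤start (suc r) = ≤-trans (m⊓n≤m _ _) (prefixMin≤start r)

prefixMin≤ : ∀ {s g r i} → i < r → prefixMin s g r ≤ g i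
prefixMin≤ {s} {g} {suc r} i<1+r with m≤n⇒m<n∨m≡n (s≤s⁻¹ i<1+r)
... | inj₁ i<r  = ≤-trans (m⊓n≤m (prefixMin s g r) (g r)) (prefixMin≤ i<r)
... | inj₂ refl = m⊓n≤n (prefixMin s g r) (g r)

≤prefixMin : ∀ {c s g} r → c ≤ s → (∀ {i} → i < r → c ≤ g i) → c ≤ prefixMin s g r
≤prefixMin zero    c≤s _     = c≤s
≤prefixMin (suc r) c≤s lower = ⊓-glb (≤prefixMin r c≤s (lower ∘ m<n⇒m<1+n)) (lower ≤-refl)

prefixMin-⊓-shift : ∀ {s t c g h} r → c + t ≤ s → (∀ {i} → i < r → g i ≡ c + h i) →
  prefixMin s g r ⊓ (c + t) ≡ c + prefixMin t h r
prefixMin-⊓-shift zero c+t≤s _ = m≥n⇒m⊓n≡n c+t≤s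
prefixMin-⊓-shift {s} {t} {c} {g} {h} (suc r) c+t≤s shifted = begin
  (prefixMin s g r ⊓ g r) ⊓ (c + t)            ≡⟨ ⊓-assoc (prefixMin s g r) (g r) (c + t) ⟩
  prefixMin s g r ⊓ (g r ⊓ (c + t))            ≡⟨ cong (prefixMin s g r ⊓_) (⊓-comm (g r) (c + t)) ⟩
  prefixMin s g r ⊓ ((c + t) ⊓ g r)            ≡⟨ sym (⊓-assoc (prefixMin s g r) (c + t) (g r)) ⟩
  (prefixMin s g r ⊓ (c + t)) ⊓ g r
    ≡⟨ cong₂ _⊓_ (prefixMin-⊓-shift r c+t≤s (shifted ∘ m<n⇒m<1+n)) (shifted ≤-refl) ⟩
  (c + prefixMin t h r) ⊓ (c + h r)            ≡⟨ sym (+-distribˡ-⊓ c (prefixMin t h r) (h r)) ⟩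
  c + (prefixMin t h r ⊓ h r)                  ∎
  where open ≡-Reasoning

blocksOf : (ℕ → ℕ) → ℕ → List Step
blocksOf V zero    = []
blocksOf V (suc r) = (replicate (V (suc r) ∸ V (suc (suc r))) d ++ [ u ]) ++ blocksOf V r

ψ : ℕ → (ℕ → ℕ) → List Step
ψ n V = blocksOf V n ++ replicate (n ∸ V 1) d

blocksOf-shift : ∀ {V V′} c r → (∀ {s} → s ≤ r → V (suc s) ≡ c + V′ (suc s)) → blocksOf V r ≡ blocksOf V′ r
blocksOf-shift c zero    _       = refl
blocksOf-shift c (suc r) shifted = cong₂ (λ e rest → (replicate e d ++ [ u ]) ++ rest)
  (trans (cong₂ _∸_ (shifted (n≤1+n r)) (shifted ≤-refl)) ([m+n]∸[m+o]≡n∸o c _ _))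
  (blocksOf-shift c r (shifted ∘ m≤n⇒m≤1+n))

blocksOf-+ : ∀ V q r → blocksOf V (q + r) ≡ blocksOf (λ s → V (s + r)) q ++ blocksOf V r
blocksOf-+ V zero    r = refl
blocksOf-+ V (suc q) r = trans (cong (block ++_) (blocksOf-+ V q r)) (sym (++-assoc block (blocksOf (λ s → V (s + r)) q) (blocksOf V r)))
  where block = replicate (V (suc q + r) ∸ V (suc (suc q + r))) d ++ [ u ]

numU-blocksOf : ∀ V r → numU (blocksOf V r) ≡ r
numU-blocksOf V zero    = refl
numU-blocksOf V (suc r) = trans (numU-++ (replicate e d ++ [ u ]) (blocksOf V r))
  (cong₂ _+_ (trans (numU-++ (replicate e d) [ u ]) (cong (_+ 1) (numU-replicate-d e))) (numU-blocksOf V r))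
  where e = V (suc r) ∸ V (suc (suc r))

numD-blocksOf : ∀ V r → (∀ {s} → s < r → V (suc (suc s)) ≤ V (suc s)) → numD (blocksOf V r) + V (suc r) ≡ V 1
numD-blocksOf V zero    _    = refl
numD-blocksOf V (suc r) mono = begin
  numD ((replicate e d ++ [ u ]) ++ blocksOf V r) + V (suc (suc r))
    ≡⟨ cong (_+ V (suc (suc r))) (trans (numD-++ (replicate e d ++ [ u ]) (blocksOf V r))
         (cong (_+ numD (blocksOf V r)) (trans (numD-++ (replicate e d) [ u ]) (trans (+-identityʳ _) (numD-replicate-d e))))) ⟩
  (e + numD (blocksOf V r)) + V (suc (suc r))
    ≡⟨ trans (cong (_+ V (suc (suc r))) (+-comm e _)) (+-assoc (numD (blocksOf V r)) e _) ⟩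
  numD (blocksOf V r) + (e + V (suc (suc r)))
    ≡⟨ cong (numD (blocksOf V r) +_) (m∸n+n≡m (mono ≤-refl)) ⟩
  numD (blocksOf V r) + V (suc r)
    ≡⟨ numD-blocksOf V r (mono ∘ m<n⇒m<1+n) ⟩
  V 1 ∎
  where
  open ≡-Reasoning
  e = V (suc r) ∸ V (suc (suc r))

blocksOf-head : ∀ V r {N} → V 0 ≡ N → ∃[ Z ] (blocksOf V r ++ replicate (N ∸ V 1) d ≡ replicate (V r ∸ V (suc r)) d ++ Z)
blocksOf-head V zero    V0≡N = [] , trans (cong (λ x → replicate (x ∸ V 1) d) (sym V0≡N)) (sym (++-identityʳ _))
blocksOf-head V (suc r) {N} _ = u ∷ blocksOf V r ++ replicate (N ∸ V 1) d ,
  trans (++-assoc (replicate e d ++ [ u ]) (blocksOf V r) _) (++-assoc (replicate e d) [ u ] _)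
  where e = V (suc r) ∸ V (suc (suc r))

-- Only the first block reads V (suc n), and it is empty once V n ≡ 0.
ψ-cong : ∀ {n V V′} → (∀ {s} → s < n → V (suc s) ≡ V′ (suc s)) → V′ n ≡ 0 → ψ n V ≡ ψ n V′
ψ-cong {zero}  {V} {V′} _     _    = cong (λ x → replicate x d) (trans (0∸n≡0 (V 1)) (sym (0∸n≡0 (V′ 1))))
ψ-cong {suc n} {V} {V′} agree V′n≡0 = cong₂ _++_
  (cong₂ (λ e rest → (replicate e d ++ [ u ]) ++ rest)
    (trans (cong (_∸ V (suc (suc n))) (trans (agree ≤-refl) V′n≡0))
      (trans (0∸n≡0 (V (suc (suc n)))) (sym (trans (cong (_∸ V′ (suc (suc n))) V′n≡0) (0∸n≡0 (V′ (suc (suc n))))))))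
    (blocksOf-shift 0 n (agree ∘ s≤s)))
  (cong (λ x → replicate (suc n ∸ x) d) (agree (s≤s z≤n)))

ψ-prefix : (ℕ → ℕ) → ℕ → ℕ → List Step
ψ-prefix V n ρ = blocksOf (λ s → V (s + suc ρ)) (n ∸ suc ρ) ++ replicate (V (suc ρ) ∸ V (suc (suc ρ))) d ++ [ u ]

ψ-split : ∀ {n V ρ} → V 0 ≡ n → ρ < n → ∃[ Z ] ψ n V ≡ ψ-prefix V n ρ ++ replicate (V ρ ∸ V (suc ρ)) d ++ Z
ψ-split {n} {V} {ρ} V0≡n ρ<n = proj₁ head , (begin
  blocksOf V n ++ T
    ≡⟨ cong (λ x → blocksOf V x ++ T) (sym (m∸n+n≡m ρ<n)) ⟩
  blocksOf V (q + suc ρ) ++ T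
    ≡⟨ cong (_++ T) (blocksOf-+ V q (suc ρ)) ⟩
  (blocksOf V′ q ++ step ++ blocksOf V ρ) ++ T
    ≡⟨ trans (++-assoc (blocksOf V′ q) (step ++ blocksOf V ρ) T)
         (trans (cong (blocksOf V′ q ++_) (++-assoc step (blocksOf V ρ) T)) (sym (++-assoc (blocksOf V′ q) step _))) ⟩
  ψ-prefix V n ρ ++ blocksOf V ρ ++ T
    ≡⟨ cong (ψ-prefix V n ρ ++_) (proj₂ head) ⟩
  ψ-prefix V n ρ ++ replicate (V ρ ∸ V (suc ρ)) d ++ proj₁ head ∎)
  where
  open ≡-Reasoning
  q = n ∸ suc ρ
  V′ = λ s → V (s + suc ρ)
  T = replicate (n ∸ V 1) d
  step = replicate (V (suc ρ) ∸ V (suc (suc ρ))) d ++ [ u ]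
  head = blocksOf-head V ρ V0≡n

numU-ψ-prefix : ∀ V {n ρ} → ρ < n → numU (ψ-prefix V n ρ) ≡ n ∸ ρ
numU-ψ-prefix V {n} {ρ} ρ<n = begin
  numU (ψ-prefix V n ρ)  ≡⟨ numU-++ (blocksOf V′ q) _ ⟩
  numU (blocksOf V′ q) + numU (replicate e d ++ [ u ])
    ≡⟨ cong₂ _+_ (numU-blocksOf V′ q) (trans (numU-++ (replicate e d) [ u ]) (cong (_+ 1) (numU-replicate-d e))) ⟩
  q + 1                  ≡⟨ m+n∸n≡m (q + 1) ρ ⟨
  q + 1 + ρ ∸ ρ          ≡⟨ cong (_∸ ρ) (trans (+-assoc q 1 ρ) (m∸n+n≡m ρ<n)) ⟩
  n ∸ ρ                  ∎
  where
  open ≡-Reasoning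
  q = n ∸ suc ρ
  V′ = λ s → V (s + suc ρ)
  e = V (suc ρ) ∸ V (suc (suc ρ))

numD-ψ-prefix : ∀ {n V ρ} → (∀ {r} → r ≤ n → V (suc r) ≤ V r) → V (suc n) ≡ 0 → ρ < n →
  numD (ψ-prefix V n ρ) ≡ V (suc ρ)
numD-ψ-prefix {n} {V} {ρ} mono V[1+n]≡0 ρ<n = begin
  numD (ψ-prefix V n ρ)
    ≡⟨ numD-++ (blocksOf V′ q) _ ⟩
  numD (blocksOf V′ q) + numD (replicate e d ++ [ u ])
    ≡⟨ cong₂ _+_ numD-rest (trans (numD-++ (replicate e d) [ u ]) (trans (+-identityʳ _) (numD-replicate-d e))) ⟩
  V (suc (suc ρ)) + e
    ≡⟨ m+[n∸m]≡n (mono ρ<n) ⟩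
  V (suc ρ) ∎
  where
  open ≡-Reasoning
  q = n ∸ suc ρ
  V′ = λ s → V (s + suc ρ)
  e = V (suc ρ) ∸ V (suc (suc ρ))
  numD-rest : numD (blocksOf V′ q) ≡ V (suc (suc ρ))
  numD-rest = begin
    numD (blocksOf V′ q)              ≡⟨ +-identityʳ _ ⟨
    numD (blocksOf V′ q) + 0          ≡⟨ cong (numD (blocksOf V′ q) +_) (trans (cong (V ∘ suc) (m∸n+n≡m ρ<n)) V[1+n]≡0) ⟨
    numD (blocksOf V′ q) + V′ (suc q)
      ≡⟨ numD-blocksOf V′ q (λ {s} s<q → mono (subst (suc s + suc ρ ≤_) (m∸n+n≡m ρ<n) (+-monoˡ-≤ (suc ρ) s<q))) ⟩
    V (suc (suc ρ))                   ∎

take-ψ-counts : ∀ {n V ρ} → (∀ {r} → r ≤ n → V (suc r) ≤ V r) → V 0 ≡ n → V (suc n) ≡ 0 →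
  ρ < n → V (suc ρ) ≤ ρ → ρ ≤ V ρ → numU (take n (ψ n V)) ≡ n ∸ ρ × numD (take n (ψ n V)) ≡ ρ
take-ψ-counts {n} {V} {ρ} mono V0≡n V[1+n]≡0 ρ<n below above =
  trans (cong numU take≡) (trans (numU-++ P _)
    (trans (cong₂ _+_ (numU-ψ-prefix V ρ<n) (numU-replicate-d j)) (+-identityʳ _))) ,
  trans (cong numD take≡) (trans (numD-++ P _)
    (trans (cong₂ _+_ (numD-ψ-prefix mono V[1+n]≡0 ρ<n) (numD-replicate-d j)) (m+[n∸m]≡n below)))
  where
  open ≡-Reasoning
  P = ψ-prefix V n ρ
  j = ρ ∸ V (suc ρ)
  split = ψ-split V0≡n ρ<n
  n≡|P|+j : n ≡ length P + j
  n≡|P|+j = begin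
    n                              ≡⟨ m+[n∸m]≡n (<⇒≤ ρ<n) ⟨
    ρ + (n ∸ ρ)                    ≡⟨ +-comm ρ (n ∸ ρ) ⟩
    (n ∸ ρ) + ρ                    ≡⟨ cong ((n ∸ ρ) +_) (m+[n∸m]≡n below) ⟨
    (n ∸ ρ) + (V (suc ρ) + j)      ≡⟨ +-assoc (n ∸ ρ) (V (suc ρ)) j ⟨
    (n ∸ ρ) + V (suc ρ) + j
      ≡⟨ cong (_+ j) (trans (length≡numU+numD P) (cong₂ _+_ (numU-ψ-prefix V ρ<n) (numD-ψ-prefix mono V[1+n]≡0 ρ<n))) ⟨
    length P + j                   ∎
  take≡ : take n (ψ n V) ≡ P ++ replicate j d
  take≡ = begin
    take n (ψ n V)
      ≡⟨ cong₂ take n≡|P|+j (proj₂ split) ⟩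
    take (length P + j) (P ++ replicate (V ρ ∸ V (suc ρ)) d ++ proj₁ split)
      ≡⟨ take-++ P j _ ⟩
    P ++ take j (replicate (V ρ ∸ V (suc ρ)) d ++ proj₁ split)
      ≡⟨ cong (P ++_) (take-replicate-++ d _ (∸-monoˡ-≤ (V (suc ρ)) above)) ⟩
    P ++ replicate j d ∎

blocks≡blocksOf : ∀ {n} (σ : Permutation′ n) r → blocks σ r ≡ blocksOf (w σ) r
blocks≡blocksOf σ zero    = refl
blocks≡blocksOf σ (suc r) = cong ((replicate (w σ (suc r) ∸ w σ (suc (suc r))) d ++ [ u ]) ++_) (blocks≡blocksOf σ r)

Ψ≡ψ : ∀ {n} (σ : Permutation′ n) → Ψ σ ≡ ψ n (w σ)
Ψ≡ψ {n} σ = cong (_++ replicate (n ∸ w σ 1) d) (blocks≡blocksOf σ n)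

prefMin≡prefixMin : ∀ {n} (σ : Permutation′ n) r → prefMin σ r ≡ prefixMin n (val σ) r
prefMin≡prefixMin σ zero    = refl
prefMin≡prefixMin σ (suc r) = cong (_⊓ val σ r) (prefMin≡prefixMin σ r)

w≡prefMin : ∀ {n} (σ : Permutation′ n) {r} → r ≤ n → w σ r ≡ prefMin σ r
w≡prefMin {n} σ {r} r≤n rewrite dec-false (r ℕ.≟ suc n) (λ { refl → <-irrefl refl r≤n }) = refl

w-last : ∀ {n} (σ : Permutation′ n) → w σ (suc n) ≡ 0
w-last {n} σ rewrite dec-true (suc n ℕ.≟ suc n) refl = refl

module NodeMinima (a b : Tree) (a-min : prefixMin (size a) (perm a) (size a) ≡ 0) where
  private
    k = size a
    m = size b
    g = perm (node a b)
    P = prefixMin (suc (k + m)) g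
    Pa = prefixMin k (perm a)
    Pb = prefixMin m (perm b)

  left-⊓ : ∀ {r} → r ≤ k → P r ⊓ (m + k) ≡ m + Pa r
  left-⊓ {r} r≤k = prefixMin-⊓-shift r (≤-trans (≤-reflexive (+-comm m k)) (n≤1+n _))
    (λ i<r → trans (perm-left a b (<-≤-trans i<r r≤k)) (+-comm _ m))

  root-min : P (suc k) ≡ m
  root-min = begin
    P k ⊓ g k         ≡⟨ cong (P k ⊓_) (trans (perm-root a b) (+-comm k m)) ⟩
    P k ⊓ (m + k)     ≡⟨ left-⊓ ≤-refl ⟩
    m + Pa k          ≡⟨ cong (m +_) a-min ⟩
    m + 0             ≡⟨ +-identityʳ m ⟩
    m                 ∎
    where open ≡-Reasoning

  left-min : ∀ {s} → s ≤ k → P (suc s) ≡ m + Pa (suc s)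
  left-min {s} s≤k with m≤n⇒m<n∨m≡n s≤k
  ... | inj₁ s<k = trans (sym (m≤n⇒m⊓n≡m P[1+s]≤m+k)) (left-⊓ s<k)
    where
    P[1+s]≤m+k : P (suc s) ≤ m + k
    P[1+s]≤m+k = ≤-trans (m⊓n≤n (P s) (g s)) (≤-trans (≤-reflexive (perm-left a b s<k))
                   (≤-trans (<⇒≤ (+-monoˡ-< m (perm-bounded a s<k))) (≤-reflexive (+-comm k m))))
  ... | inj₂ refl = trans root-min (sym (trans (cong (λ x → m + (x ⊓ perm a k)) a-min) (+-identityʳ m)))

  right-min : ∀ s → P (s + suc k) ≡ Pb s
  right-min s = trans (prefixMin-+ s (suc k)) (trans (cong (λ x → prefixMin x (λ i → g (i + suc k)) s) root-min)
    (prefixMin-cong s (λ {i} _ → trans (cong g (trans (+-suc i k) (cong suc (+-comm i k)))) (perm-right a b i))))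

prefixMin-perm : ∀ t → prefixMin (size t) (perm t) (size t) ≡ 0
prefixMin-perm leaf       = refl
prefixMin-perm (node a b) = trans (cong (prefixMin _ _) (sym (trans (+-suc (size b) (size a)) (cong suc (+-comm (size b) (size a))))))
  (trans (NodeMinima.right-min a b (prefixMin-perm a) (size b)) (prefixMin-perm b))

ψ-perm : ∀ t → ψ (size t) (prefixMin (size t) (perm t)) ≡ word t
ψ-perm leaf       = refl
ψ-perm (node a b) = begin
  blocksOf P n ++ replicate (n ∸ P 1) d
    ≡⟨ cong₂ _++_ (trans (cong (blocksOf P) n≡m+[1+k]) (blocksOf-+ P m (suc k))) (cong (λ x → replicate x d) last-run) ⟩
  (blocksOf (λ s → P (s + suc k)) m ++ (replicate (P (suc k) ∸ P (suc (suc k))) d ++ [ u ]) ++ blocksOf P k)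
    ++ replicate (suc (k ∸ Pa 1)) d
    ≡⟨ cong₂ (λ x y → (x ++ y) ++ replicate (suc (k ∸ Pa 1)) d)
         (blocksOf-shift 0 m (λ {s} _ → right-min (suc s)))
         (cong₂ (λ e rest → (replicate e d ++ [ u ]) ++ rest) (cong₂ _∸_ root-min (right-min 1)) (blocksOf-shift m k left-min)) ⟩
  (blocksOf Pb m ++ (replicate (m ∸ Pb 1) d ++ [ u ]) ++ blocksOf Pa k) ++ replicate (suc (k ∸ Pa 1)) d
    ≡⟨ cong ((blocksOf Pb m ++ (replicate (m ∸ Pb 1) d ++ [ u ]) ++ blocksOf Pa k) ++_) (replicate-∷ʳ (k ∸ Pa 1) d) ⟩
  (blocksOf Pb m ++ (replicate (m ∸ Pb 1) d ++ [ u ]) ++ blocksOf Pa k) ++ replicate (k ∸ Pa 1) d ++ [ d ]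
    ≡⟨ reassociate (blocksOf Pb m) (replicate (m ∸ Pb 1) d) (blocksOf Pa k) (replicate (k ∸ Pa 1) d) ⟩
  ψ m Pb ++ u ∷ ψ k Pa ++ [ d ]
    ≡⟨ cong₂ (λ x y → x ++ u ∷ y ++ [ d ]) (ψ-perm b) (ψ-perm a) ⟩
  word (node a b) ∎
  where
  open ≡-Reasoning
  open NodeMinima a b (prefixMin-perm a)
  k = size a
  m = size b
  n = suc (k + m)
  P = prefixMin n (perm (node a b))
  Pa = prefixMin k (perm a)
  Pb = prefixMin m (perm b)
  n≡m+[1+k] : n ≡ m + suc k
  n≡m+[1+k] = sym (trans (+-suc m k) (cong suc (+-comm m k)))
  last-run : n ∸ P 1 ≡ suc (k ∸ Pa 1)
  last-run = begin
    n ∸ P 1                  ≡⟨ cong₂ _∸_ n≡m+[1+k] (left-min z≤n) ⟩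
    (m + suc k) ∸ (m + Pa 1) ≡⟨ [m+n]∸[m+o]≡n∸o m (suc k) (Pa 1) ⟩
    suc k ∸ Pa 1             ≡⟨ +-∸-assoc 1 {k} (prefixMin≤start {g = perm a} 1) ⟩
    suc (k ∸ Pa 1)           ∎
  reassociate : ∀ B R A F → (B ++ (R ++ [ u ]) ++ A) ++ F ++ [ d ] ≡ (B ++ R) ++ u ∷ (A ++ F) ++ [ d ]
  reassociate []      []      A F = cong (u ∷_) (sym (++-assoc A F [ d ]))
  reassociate []      (x ∷ R) A F = cong (x ∷_) (reassociate [] R A F)
  reassociate (x ∷ B) R       A F = cong (x ∷_) (reassociate B R A F)

Ψ≡word : ∀ {n} (σ : Permutation′ n) t → size t ≡ n → AgreeBelow n (val σ) (perm t) → Ψ σ ≡ word t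
Ψ≡word {n} σ t refl agree = begin
  Ψ σ                                       ≡⟨ Ψ≡ψ σ ⟩
  ψ n (w σ)                                 ≡⟨ ψ-cong w≡prefixMin (prefixMin-perm t) ⟩
  ψ n (prefixMin n (perm t))                ≡⟨ ψ-perm t ⟩
  word t                                    ∎
  where
  open ≡-Reasoning
  w≡prefixMin : ∀ {s} → s < n → w σ (suc s) ≡ prefixMin n (perm t) (suc s)
  w≡prefixMin {s} s<n = trans (w≡prefMin σ s<n) (trans (prefMin≡prefixMin σ (suc s))
    (prefixMin-cong (suc s) (λ i≤s → agree (<-≤-trans i≤s s<n))))

-- Tunnels

Tunnel : Set
Tunnel = List Step × List Step × List Step

prependA : List Step → Tunnel → Tunnel
prependA X = map₁ (X ++_)

appendC : List Step → Tunnel → Tunnel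
appendC Y = map₂ (map₂ (_++ Y))

closingSplits : List Step → List (List Step × List Step)
closingSplits []      = []
closingSplits (u ∷ D) = map (map₁ (u ∷_)) (closingSplits D)
closingSplits (d ∷ D) = ([] , D) ∷ map (map₁ (d ∷_)) (closingSplits D)

concatMap-splits-∷ : ∀ {X Y : Set} (f : List X × List X → List Y) (g : Y → Y) x w →
  (∀ A R → f (x ∷ A , R) ≡ map g (f (A , R))) →
  concatMap f (splits (x ∷ w)) ≡ f ([] , x ∷ w) ++ map g (concatMap f (splits w))
concatMap-splits-∷ f g x w shift = cong (f ([] , x ∷ w) ++_) (begin
  concatMap f (map (map₁ (x ∷_)) (splits w))  ≡⟨ concatMap-map f (map₁ (x ∷_)) (splits w) ⟩
  concatMap (f ∘ map₁ (x ∷_)) (splits w)       ≡⟨ concatMap-cong (λ (A , R) → shift A R) (splits w) ⟩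
  concatMap (map g ∘ f) (splits w)             ≡⟨ map-concatMap g f (splits w) ⟨
  map g (concatMap f (splits w))               ∎)
  where open ≡-Reasoning

tunnelCandidates : List Step → List Tunnel
tunnelCandidates []      = []
tunnelCandidates (u ∷ D) = map ([] ,_) (closingSplits D) ++ map (prependA [ u ]) (tunnelCandidates D)
tunnelCandidates (d ∷ D) = map (prependA [ d ]) (tunnelCandidates D)

-- `uBdSplits` is built from two functions local to its definition; these two lemmas
-- describe `concatMap` of any functions satisfying the same defining equations.
concatMap-inner : ∀ (inner : List Step → List Step × List Step → List Tunnel) →
  (∀ A B C → inner A (B , d ∷ C) ≡ [ (A , B , C) ]) → (∀ A B C → inner A (B , u ∷ C) ≡ []) →
  (∀ A B → inner A (B , []) ≡ []) → ∀ A R → concatMap (inner A) (splits R) ≡ map (A ,_) (closingSplits R)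
concatMap-inner inner at-d at-u at-[] A = go
  where
  grow : ∀ x B S → inner A (x ∷ B , S) ≡ map (map₂ (map₁ (x ∷_))) (inner A (B , S))
  grow x B []      = trans (at-[] A (x ∷ B)) (cong (map _) (sym (at-[] A B)))
  grow x B (u ∷ S) = trans (at-u A (x ∷ B) S) (cong (map _) (sym (at-u A B S)))
  grow x B (d ∷ S) = trans (at-d A (x ∷ B) S) (cong (map _) (sym (at-d A B S)))
  go : ∀ R → concatMap (inner A) (splits R) ≡ map (A ,_) (closingSplits R)
  go []      = cong (_++ []) (at-[] A [])
  go (u ∷ R) = trans (concatMap-splits-∷ (inner A) _ u R (grow u))
    (cong₂ _++_ (at-u A [] R) (trans (cong (map _) (go R)) (map-∘-comm (λ _ → refl) (closingSplits R))))
  go (d ∷ R) = trans (concatMap-splits-∷ (inner A) _ d R (grow d))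
    (cong₂ _++_ (at-d A [] R) (trans (cong (map _) (go R)) (map-∘-comm (λ _ → refl) (closingSplits R))))

concatMap-outer : ∀ (outer : List Step × List Step → List Tunnel) →
  (∀ A R → outer (A , u ∷ R) ≡ map (A ,_) (closingSplits R)) → (∀ A R → outer (A , d ∷ R) ≡ []) →
  (∀ A → outer (A , []) ≡ []) → ∀ D → concatMap outer (splits D) ≡ tunnelCandidates D
concatMap-outer outer at-u at-d at-[] = go
  where
  grow : ∀ x A S → outer (x ∷ A , S) ≡ map (prependA [ x ]) (outer (A , S))
  grow x A []      = trans (at-[] (x ∷ A)) (cong (map _) (sym (at-[] A)))
  grow x A (u ∷ S) = trans (at-u (x ∷ A) S)
    (trans (map-∘ {g = prependA [ x ]} {f = A ,_} (closingSplits S)) (cong (map _) (sym (at-u A S))))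
  grow x A (d ∷ S) = trans (at-d (x ∷ A) S) (cong (map _) (sym (at-d A S)))
  go : ∀ D → concatMap outer (splits D) ≡ tunnelCandidates D
  go []      = cong (_++ []) (at-[] [])
  go (u ∷ D) = trans (concatMap-splits-∷ outer _ u D (grow u)) (cong₂ _++_ (at-u [] D) (cong (map _) (go D)))
  go (d ∷ D) = trans (concatMap-splits-∷ outer _ d D (grow d)) (cong₂ _++_ (at-d [] D) (cong (map _) (go D)))

uBdSplits≡tunnelCandidates : ∀ D → uBdSplits D ≡ tunnelCandidates D
uBdSplits≡tunnelCandidates D = concatMap-outer _
  (concatMap-inner _ (λ _ _ _ → refl) (λ _ _ _ → refl) (λ _ _ → refl)) (λ _ _ → refl) (λ _ → refl) D

middleDyck? : Decidable {A = Tunnel} (λ τ → IsDyckWord (proj₁ (proj₂ τ)))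
middleDyck? τ = isDyckWord? (proj₁ (proj₂ τ))

dyckClosings : List Step → List (List Step × List Step)
dyckClosings D = filter (isDyckWord? ∘ proj₁) (closingSplits D)

tunnels≡ : ∀ D → tunnels D ≡ filter middleDyck? (tunnelCandidates D)
tunnels≡ D = cong (filter middleDyck?) (uBdSplits≡tunnelCandidates D)

map-tunnels-u∷ : ∀ {X : Set} (F : Tunnel → X) D →
  map F (tunnels (u ∷ D)) ≡ map (F ∘ ([] ,_)) (dyckClosings D) ++ map (F ∘ prependA [ u ]) (tunnels D)
map-tunnels-u∷ F D = begin
  map F (tunnels (u ∷ D))
    ≡⟨ cong (map F) (trans (tunnels≡ (u ∷ D)) (filter-++ middleDyck? (map ([] ,_) (closingSplits D)) _)) ⟩
  map F (filter middleDyck? (map ([] ,_) (closingSplits D)) ++ filter middleDyck? (map (prependA [ u ]) (tunnelCandidates D)))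
    ≡⟨ cong (map F) (cong₂ _++_ (filter-map middleDyck? ([] ,_) (closingSplits D))
                                 (filter-map middleDyck? (prependA [ u ]) (tunnelCandidates D))) ⟩
  map F (map ([] ,_) (dyckClosings D) ++ map (prependA [ u ]) (filter middleDyck? (tunnelCandidates D)))
    ≡⟨ map-++ F (map ([] ,_) (dyckClosings D)) (map (prependA [ u ]) (filter middleDyck? (tunnelCandidates D))) ⟩
  map F (map ([] ,_) (dyckClosings D)) ++ map F (map (prependA [ u ]) (filter middleDyck? (tunnelCandidates D)))
    ≡⟨ cong₂ _++_ (map-∘ (dyckClosings D))
                  (trans (cong (map (F ∘ prependA [ u ])) (tunnels≡ D)) (map-∘ (filter middleDyck? (tunnelCandidates D)))) ⟨
  map (F ∘ ([] ,_)) (dyckClosings D) ++ map (F ∘ prependA [ u ]) (tunnels D) ∎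
  where open ≡-Reasoning

map-tunnels-d∷ : ∀ {X : Set} (F : Tunnel → X) D → map F (tunnels (d ∷ D)) ≡ map (F ∘ prependA [ d ]) (tunnels D)
map-tunnels-d∷ F D = begin
  map F (tunnels (d ∷ D))
    ≡⟨ cong (map F) (trans (tunnels≡ (d ∷ D)) (filter-map middleDyck? (prependA [ d ]) (tunnelCandidates D))) ⟩
  map F (map (prependA [ d ]) (filter middleDyck? (tunnelCandidates D)))  ≡⟨ map-∘ (filter middleDyck? (tunnelCandidates D)) ⟨
  map (F ∘ prependA [ d ]) (filter middleDyck? (tunnelCandidates D))      ≡⟨ cong (map (F ∘ prependA [ d ])) (tunnels≡ D) ⟨
  map (F ∘ prependA [ d ]) (tunnels D)                               ∎
  where open ≡-Reasoning

Closes : ℕ → List Step × List Step → Set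
Closes h (B , _) = height h B ≡ just 0

closes? : ∀ h → Decidable (Closes h)
closes? h (B , _) = ≡-dec-Maybe ℕ._≟_ (height h B) (just 0)

closingsAt : ℕ → List Step → List (List Step × List Step)
closingsAt h D = filter (closes? h) (closingSplits D)

dyckClosings≡closingsAt : ∀ D → dyckClosings D ≡ closingsAt 0 D
dyckClosings≡closingsAt D = filter-≐ _ _
  ((λ {p} → Equivalence.to (isDyckWord⇔height (proj₁ p))) , (λ {p} → Equivalence.from (isDyckWord⇔height (proj₁ p))))
  (closingSplits D)

closingsAt-u∷ : ∀ h D → closingsAt h (u ∷ D) ≡ map (map₁ (u ∷_)) (closingsAt (suc h) D)
closingsAt-u∷ h D = filter-map (closes? h) (map₁ (u ∷_)) (closingSplits D)

closingsAt-d∷ : ∀ h D → closingsAt (suc h) (d ∷ D) ≡ map (map₁ (d ∷_)) (closingsAt h D)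
closingsAt-d∷ h D = trans (filter-reject (closes? (suc h)) {([] , D)} {map (map₁ (d ∷_)) (closingSplits D)} λ ())
  (filter-map (closes? (suc h)) (map₁ (d ∷_)) (closingSplits D))

closingsAt-ground : ∀ D → closingsAt 0 (d ∷ D) ≡ [ ([] , D) ]
closingsAt-ground D = trans (filter-accept (closes? 0) {([] , D)} {map (map₁ (d ∷_)) (closingSplits D)} refl) (cong (([] , D) ∷_)
  (trans (filter-map (closes? 0) (map₁ (d ∷_)) (closingSplits D))
    (cong (map (map₁ (d ∷_))) (filter-none (closes? 0 ∘ map₁ (d ∷_)) (All.universal (λ _ ()) (closingSplits D))))))

closingsAt-word-++ : ∀ {X : Set} (F : List Step × List Step → X) t h Y →
  map F (closingsAt h (word t ++ Y)) ≡ map (F ∘ map₁ (word t ++_)) (closingsAt h Y)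
closingsAt-word-++ F leaf       h Y = refl
closingsAt-word-++ F (node a b) h Y = begin
  map F (closingsAt h (word (node a b) ++ Y))
    ≡⟨ cong (map F ∘ closingsAt h) (word-++ a b Y) ⟩
  map F (closingsAt h (word b ++ u ∷ word a ++ d ∷ Y))
    ≡⟨ closingsAt-word-++ F b h (u ∷ word a ++ d ∷ Y) ⟩
  map Fb (closingsAt h (u ∷ word a ++ d ∷ Y))
    ≡⟨ trans (cong (map Fb) (closingsAt-u∷ h (word a ++ d ∷ Y))) (sym (map-∘ (closingsAt (suc h) (word a ++ d ∷ Y)))) ⟩
  map (Fb ∘ map₁ (u ∷_)) (closingsAt (suc h) (word a ++ d ∷ Y))
    ≡⟨ closingsAt-word-++ (Fb ∘ map₁ (u ∷_)) a (suc h) (d ∷ Y) ⟩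
  map (Fb ∘ map₁ (u ∷_) ∘ map₁ (word a ++_)) (closingsAt (suc h) (d ∷ Y))
    ≡⟨ trans (cong (map (Fb ∘ map₁ (u ∷_) ∘ map₁ (word a ++_))) (closingsAt-d∷ h Y)) (sym (map-∘ (closingsAt h Y))) ⟩
  map (Fb ∘ map₁ (u ∷_) ∘ map₁ (word a ++_) ∘ map₁ (d ∷_)) (closingsAt h Y)
    ≡⟨ map-cong (λ (B , C) → cong (λ A → F (A , C)) (sym (word-++ a b B))) (closingsAt h Y) ⟩
  map (F ∘ map₁ (word (node a b) ++_)) (closingsAt h Y) ∎
  where
  open ≡-Reasoning
  Fb = F ∘ map₁ (word b ++_)

dyckClosings-word : ∀ t Y → dyckClosings (word t ++ d ∷ Y) ≡ [ (word t , Y) ]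
dyckClosings-word t Y = begin
  dyckClosings (word t ++ d ∷ Y)                  ≡⟨ dyckClosings≡closingsAt (word t ++ d ∷ Y) ⟩
  closingsAt 0 (word t ++ d ∷ Y)                  ≡⟨ map-id (closingsAt 0 (word t ++ d ∷ Y)) ⟨
  map id (closingsAt 0 (word t ++ d ∷ Y))         ≡⟨ closingsAt-word-++ id t 0 (d ∷ Y) ⟩
  map (map₁ (word t ++_)) (closingsAt 0 (d ∷ Y))  ≡⟨ cong (map (map₁ (word t ++_))) (closingsAt-ground Y) ⟩
  [ (word t ++ [] , Y) ]                          ≡⟨ cong (λ A → [ (A , Y) ]) (++-identityʳ (word t)) ⟩
  [ (word t , Y) ]                                ∎
  where open ≡-Reasoning

tunnels-word-++ : ∀ {X : Set} (F : Tunnel → X) t Y →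
  map F (tunnels (word t ++ Y)) ≡ map (F ∘ appendC Y) (tunnels (word t)) ++ map (F ∘ prependA (word t)) (tunnels Y)

tunnels-elevated-++ : ∀ {X : Set} (H : Tunnel → X) a Y → map H (tunnels (u ∷ word a ++ d ∷ Y)) ≡
  H ([] , word a , Y) ∷ (map (H ∘ prependA [ u ] ∘ appendC (d ∷ Y)) (tunnels (word a))
                         ++ map (H ∘ prependA (u ∷ word a ++ [ d ])) (tunnels Y))
tunnels-elevated-++ H a Y = begin
  map H (tunnels (u ∷ word a ++ d ∷ Y))
    ≡⟨ map-tunnels-u∷ H (word a ++ d ∷ Y) ⟩
  map (H ∘ ([] ,_)) (dyckClosings (word a ++ d ∷ Y)) ++ map (H ∘ prependA [ u ]) (tunnels (word a ++ d ∷ Y))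
    ≡⟨ cong₂ _++_ (cong (map (H ∘ ([] ,_))) (dyckClosings-word a Y)) (tunnels-word-++ (H ∘ prependA [ u ]) a (d ∷ Y)) ⟩
  H ([] , word a , Y) ∷ (map (H ∘ prependA [ u ] ∘ appendC (d ∷ Y)) Ta ++ map (H ∘ prependA (u ∷ word a)) (tunnels (d ∷ Y)))
    ≡⟨ cong (λ L → H ([] , word a , Y) ∷ (map (H ∘ prependA [ u ] ∘ appendC (d ∷ Y)) Ta ++ L))
         (trans (map-tunnels-d∷ (H ∘ prependA (u ∷ word a)) Y)
                (map-cong (λ (A , B , C) → cong (λ A′ → H (A′ , B , C)) (cong (u ∷_) (sym (++-assoc (word a) [ d ] A))))
                          (tunnels Y))) ⟩
  H ([] , word a , Y) ∷ (map (H ∘ prependA [ u ] ∘ appendC (d ∷ Y)) Ta ++ map (H ∘ prependA (u ∷ word a ++ [ d ])) (tunnels Y)) ∎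
  where
  open ≡-Reasoning
  Ta = tunnels (word a)

tunnels-word-++ F leaf       Y = refl
tunnels-word-++ F (node a b) Y = begin
  map F (tunnels (word (node a b) ++ Y))
    ≡⟨ cong (map F ∘ tunnels) (word-++ a b Y) ⟩
  map F (tunnels (word b ++ u ∷ word a ++ d ∷ Y))
    ≡⟨ tunnels-word-++ F b (u ∷ word a ++ d ∷ Y) ⟩
  map (F ∘ appendC (u ∷ word a ++ d ∷ Y)) Tb ++ map (F ∘ prependA (word b)) (tunnels (u ∷ word a ++ d ∷ Y))
    ≡⟨ cong₂ _++_ (map-cong (λ (A , B , C) → cong (λ C′ → F (A , B , C′)) (sym (C-assoc C))) Tb)
                  (tunnels-elevated-++ (F ∘ prependA (word b)) a Y) ⟩
  Lb ++ r ∷ (map (F ∘ prependA (word b) ∘ prependA [ u ] ∘ appendC (d ∷ Y)) Ta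
             ++ map (F ∘ prependA (word b) ∘ prependA (u ∷ word a ++ [ d ])) (tunnels Y))
    ≡⟨ cong (λ L → Lb ++ r ∷ L) (cong₂ _++_
         (trans (map-cong (λ (A , B , C) → cong (λ C′ → F (word b ++ u ∷ A , B , C′)) (sym (++-assoc C [ d ] Y))) Ta)
                (sym (++-identityʳ _)))
         (map-cong (λ (A , B , C) → cong (λ A′ → F (A′ , B , C)) (sym (++-assoc (word b) Z₀ A))) (tunnels Y))) ⟩
  Lb ++ r ∷ (La ++ []) ++ LY
    ≡⟨ sym (++-assoc Lb (r ∷ (La ++ [])) LY) ⟩
  (Lb ++ r ∷ (La ++ [])) ++ LY
    ≡⟨ cong (λ L → (Lb ++ L) ++ LY) (sym (tunnels-elevated-++ (F ∘ appendC Y ∘ prependA (word b)) a [])) ⟩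
  (Lb ++ map (F ∘ appendC Y ∘ prependA (word b)) (tunnels Z₀)) ++ LY
    ≡⟨ cong (_++ LY) (sym (tunnels-word-++ (F ∘ appendC Y) b Z₀)) ⟩
  map (F ∘ appendC Y) (tunnels (word (node a b))) ++ LY ∎
  where
  open ≡-Reasoning
  Ta = tunnels (word a)
  Tb = tunnels (word b)
  Z₀ = u ∷ word a ++ [ d ]
  Lb = map (F ∘ appendC Y ∘ appendC Z₀) Tb
  r  = F (word b ++ [] , word a , Y)
  La = map (F ∘ appendC Y ∘ prependA (word b) ∘ prependA [ u ] ∘ appendC [ d ]) Ta
  LY = map (F ∘ prependA (word (node a b))) (tunnels Y)
  C-assoc : ∀ C → (C ++ Z₀) ++ Y ≡ C ++ u ∷ word a ++ d ∷ Y
  C-assoc C = trans (++-assoc C Z₀ Y) (cong (λ z → C ++ u ∷ z) (++-assoc (word a) [ d ] Y))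

ShiftInvariant : {X : Set} → (ℕ → ℕ → X) → Set
ShiftInvariant f = ∀ a c → f (suc a) (suc c) ≡ f a c

shiftInvariant-+ : ∀ {X : Set} {f : ℕ → ℕ → X} → ShiftInvariant f → ∀ k a c → f (k + a) (k + c) ≡ f a c
shiftInvariant-+ inv zero    a c = refl
shiftInvariant-+ inv (suc k) a c = trans (inv (k + a) (k + c)) (shiftInvariant-+ inv k a c)

shape : {X : Set} → (ℕ → ℕ → X) → Tunnel → X
shape f (A , _ , C) = f (length A) (length C)

tunnelShapes-word : ∀ {X : Set} (f : ℕ → ℕ → X) → ShiftInvariant f → ∀ t →
  map (shape f) (tunnels (word t)) ≡ applyDownFrom (λ i → f (2 * perm t i) (2 * i)) (size t)
tunnelShapes-word f inv leaf       = refl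
tunnelShapes-word f inv (node a b) = begin
  map (shape f) (tunnels (word b ++ Z₀))
    ≡⟨ tunnels-word-++ (shape f) b Z₀ ⟩
  map (shape f ∘ appendC Z₀) Tb ++ map (shape f ∘ prependA (word b)) (tunnels Z₀)
    ≡⟨ cong (map (shape f ∘ appendC Z₀) Tb ++_) (tunnels-elevated-++ (shape f ∘ prependA (word b)) a []) ⟩
  map (shape f ∘ appendC Z₀) Tb ++ shape f (word b ++ [] , word a , []) ∷
    (map (shape f ∘ prependA (word b) ∘ prependA [ u ] ∘ appendC [ d ]) Ta ++ [])
    ≡⟨ cong₂ _++_ (map-cong b-shape Tb) (cong₂ _∷_ root-shape (trans (++-identityʳ _) (map-cong a-shape Ta))) ⟩
  map (shape fb) Tb ++ f (2 * mb) 0 ∷ map (shape fa) Ta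
    ≡⟨ cong₂ (λ L L′ → L ++ f (2 * mb) 0 ∷ L′) (tunnelShapes-word fb (λ a c → inv a (c + 2 * suc ka)) b)
                                                (tunnelShapes-word fa (λ a c → inv (a + 2 * mb) c) a) ⟩
  applyDownFrom (λ j → fb (2 * perm b j) (2 * j)) mb ++ f (2 * mb) 0 ∷ applyDownFrom (λ i → fa (2 * perm a i) (2 * i)) ka
    ≡⟨ cong₂ _++_ (applyDownFrom-cong mb (λ {j} _ → right-position j))
                  (cong₂ _∷_ root-position (applyDownFrom-cong ka left-position)) ⟨
  applyDownFrom (λ j → G (suc (ka + j))) mb ++ G ka ∷ applyDownFrom G ka
    ≡⟨ applyDownFrom-split G ka mb ⟨
  applyDownFrom G (suc (ka + mb)) ∎
  where
  open ≡-Reasoning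
  ka = size a
  mb = size b
  Ta = tunnels (word a)
  Tb = tunnels (word b)
  Z₀ = u ∷ word a ++ [ d ]
  fb fa : ℕ → ℕ → _
  fb a c = f a (c + 2 * suc ka)
  fa a c = f (a + 2 * mb) c
  G : ℕ → _
  G i = f (2 * perm (node a b) i) (2 * i)
  b-shape : ∀ τ → shape f (appendC Z₀ τ) ≡ shape fb τ
  b-shape (A , B , C) = cong (f (length A)) (trans (length-++ C)
    (cong (length C +_) (trans (length-word (node a leaf)) (cong (λ x → 2 * suc x) (+-identityʳ ka)))))
  root-shape : shape f (word b ++ [] , word a , []) ≡ f (2 * mb) 0
  root-shape = cong (λ x → f x 0) (trans (cong length (++-identityʳ (word b))) (length-word b))
  a-shape : ∀ τ → shape f (prependA (word b) (prependA [ u ] (appendC [ d ] τ))) ≡ shape fa τ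
  a-shape (A , B , C) = trans (cong₂ f
    (trans (length-++ (word b)) (trans (cong (_+ suc (length A)) (length-word b))
      (trans (+-suc (2 * mb) (length A)) (cong suc (+-comm (2 * mb) (length A))))))
    (trans (length-++ C) (+-comm (length C) 1))) (inv _ _)
  right-position : ∀ j → G (suc (ka + j)) ≡ fb (2 * perm b j) (2 * j)
  right-position j = cong₂ f (cong (2 *_) (perm-right a b j))
    (trans (cong (2 *_) (trans (cong suc (+-comm ka j)) (sym (+-suc j ka)))) (*-distribˡ-+ 2 j (suc ka)))
  root-position : G ka ≡ f (2 * mb) 0
  root-position = trans (cong₂ f (trans (cong (2 *_) (perm-root a b)) (*-distribˡ-+ 2 ka mb)) (sym (+-identityʳ (2 * ka))))
    (shiftInvariant-+ inv (2 * ka) (2 * mb) 0)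
  left-position : AgreeBelow ka G (λ i → fa (2 * perm a i) (2 * i))
  left-position {i} i<k = cong (λ x → f x (2 * i)) (trans (cong (2 *_) (perm-left a b i<k)) (*-distribˡ-+ 2 (perm a i) mb))

-- Fixed points and excedances

data Cmp : Set where
  lt eq gt : Cmp

cmp : ℕ → ℕ → Cmp
cmp zero    zero    = eq
cmp zero    (suc _) = lt
cmp (suc _) zero    = gt
cmp (suc a) (suc c) = cmp a c

_≟ᶜ_ : DecidableEquality Cmp
lt ≟ᶜ lt = yes refl
eq ≟ᶜ eq = yes refl
gt ≟ᶜ gt = yes refl
lt ≟ᶜ eq = no λ ()
lt ≟ᶜ gt = no λ ()
eq ≟ᶜ lt = no λ ()
eq ≟ᶜ gt = no λ ()
gt ≟ᶜ lt = no λ ()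
gt ≟ᶜ eq = no λ ()

cmp-double : ∀ a c → cmp (2 * a) (2 * c) ≡ cmp a c
cmp-double zero    zero    = refl
cmp-double zero    (suc c) = refl
cmp-double (suc a) zero    = refl
cmp-double (suc a) (suc c) rewrite +-suc a (a + 0) | +-suc c (c + 0) = cmp-double a c

≡⇔cmp≡eq : ∀ a c → a ≡ c ⇔ cmp a c ≡ eq
≡⇔cmp≡eq zero    zero    = mk⇔ (λ _ → refl) (λ _ → refl)
≡⇔cmp≡eq zero    (suc c) = mk⇔ (λ ()) (λ ())
≡⇔cmp≡eq (suc a) zero    = mk⇔ (λ ()) (λ ())
≡⇔cmp≡eq (suc a) (suc c) =
  mk⇔ (Equivalence.to (≡⇔cmp≡eq a c) ∘ suc-injective) (cong suc ∘ Equivalence.from (≡⇔cmp≡eq a c))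

>⇔cmp≡gt : ∀ a c → c < a ⇔ cmp a c ≡ gt
>⇔cmp≡gt zero    zero    = mk⇔ (λ ()) (λ ())
>⇔cmp≡gt zero    (suc c) = mk⇔ (λ ()) (λ ())
>⇔cmp≡gt (suc a) zero    = mk⇔ (λ _ → refl) (λ _ → s≤s z≤n)
>⇔cmp≡gt (suc a) (suc c) = mk⇔ (Equivalence.to (>⇔cmp≡gt a c) ∘ s≤s⁻¹) (s≤s ∘ Equivalence.from (>⇔cmp≡gt a c))

count : Cmp → List Cmp → ℕ
count c = length ∘ filter (_≟ᶜ c)

count-positions : ∀ {n} {R : Fin n → Fin n → Set} (R? : ∀ x y → Dec (R x y)) (σ : Permutation′ n) c →
  (∀ x y → R x y ⇔ cmp (toℕ x) (toℕ y) ≡ c) →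
  length (filter (λ i → R? (σ ⟨$⟩ʳ i) i) (allFin n)) ≡ count c (applyDownFrom (λ i → cmp (val σ i) i) n)
count-positions {n} R? σ c R⇔ = begin
  length (filter (λ i → R? (σ ⟨$⟩ʳ i) i) (allFin n))
    ≡⟨ length-filter-map _ (_≟ᶜ c) (λ i → cmp (toℕ (σ ⟨$⟩ʳ i)) (toℕ i)) (λ i → R⇔ (σ ⟨$⟩ʳ i) i) (allFin n) ⟩
  count c (map (λ i → cmp (toℕ (σ ⟨$⟩ʳ i)) (toℕ i)) (allFin n))
    ≡⟨ cong (count c) (trans (map-tabulate id _) (trans (tabulate-cong (λ i → cong (λ v → cmp v (toℕ i)) (sym (val-toℕ σ i))))
         (tabulate-toℕ n (λ i → cmp (val σ i) i)))) ⟩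
  count c (applyUpTo (λ i → cmp (val σ i) i) n)
    ≡⟨ ↭-length (filter-↭ (_≟ᶜ c) (↭-reverse (applyUpTo _ n))) ⟨
  count c (reverse (applyUpTo (λ i → cmp (val σ i) i) n))
    ≡⟨ cong (count c) (reverse-applyUpTo _ n) ⟩
  count c (applyDownFrom (λ i → cmp (val σ i) i) n) ∎
  where open ≡-Reasoning

count-tunnels : ∀ {R : ℕ → ℕ → Set} (R? : ∀ a b → Dec (R a b)) c → (∀ a b → R a b ⇔ cmp a b ≡ c) → ∀ D →
  length (filter (λ τ → R? (length (proj₁ τ)) (length (proj₂ (proj₂ τ)))) (tunnels D)) ≡ count c (map (shape cmp) (tunnels D))
count-tunnels R? c R⇔ D = length-filter-map _ (_≟ᶜ c) (shape cmp) (λ τ → R⇔ _ _) (tunnels D)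

tunnelProfile-word : ∀ t → map (shape cmp) (tunnels (word t)) ≡ applyDownFrom (λ i → cmp (perm t i) i) (size t)
tunnelProfile-word t = trans (tunnelShapes-word cmp (λ _ _ → refl) t)
  (applyDownFrom-cong (size t) (λ {i} _ → cmp-double (perm t i) i))

positions≡tunnels : ∀ {n} (σ : Permutation′ n) t → size t ≡ n → AgreeBelow n (val σ) (perm t) → ∀ c →
  count c (applyDownFrom (λ i → cmp (val σ i) i) n) ≡ count c (map (shape cmp) (tunnels (word t)))
positions≡tunnels σ t refl agree c = cong (count c) (trans
  (applyDownFrom-cong (size t) (λ i<n → cong₂ cmp (agree i<n) refl)) (sym (tunnelProfile-word t)))

fp≡ct : ∀ {n} (σ : Permutation′ n) t → size t ≡ n → AgreeBelow n (val σ) (perm t) → fp σ ≡ ct (word t)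
fp≡ct σ t |t| agree = trans (count-positions FP._≟_ σ eq fin≡⇔)
  (trans (positions≡tunnels σ t |t| agree eq) (sym (count-tunnels ℕ._≟_ eq ≡⇔cmp≡eq (word t))))
  where
  fin≡⇔ : ∀ x y → x ≡ y ⇔ cmp (toℕ x) (toℕ y) ≡ eq
  fin≡⇔ x y = mk⇔ (Equivalence.to (≡⇔cmp≡eq _ _) ∘ cong toℕ) (FP.toℕ-injective ∘ Equivalence.from (≡⇔cmp≡eq _ _))

exc≡rt : ∀ {n} (σ : Permutation′ n) t → size t ≡ n → AgreeBelow n (val σ) (perm t) → exc σ ≡ rt (word t)
exc≡rt σ t |t| agree = trans (count-positions (λ x y → y F.<? x) σ gt (λ x y → >⇔cmp≡gt (toℕ x) (toℕ y)))
  (trans (positions≡tunnels σ t |t| agree gt) (sym (count-tunnels (λ a c → c <? a) gt >⇔cmp≡gt (word t))))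

-- The rank

LargestRkOk : ∀ {n} → Permutation′ n → ℕ → ℕ → Set
LargestRkOk σ N ρ = ρ ≤ N × RkOk σ ρ × (∀ {j} → ρ < j → j ≤ N → ¬ RkOk σ j)

if-does : ∀ {P A : Set} (P? : Dec P) (B : A → Set) {x y} → (P → B x) → (¬ P → B y) → B (if does P? then x else y)
if-does (yes p)  B on-yes _     = on-yes p
if-does (no ¬p)  B _      on-no = on-no ¬p

rkFrom-largest : ∀ {n} (σ : Permutation′ n) N → LargestRkOk σ N (rkFrom σ N)
rkFrom-largest σ zero    = z≤n , (λ _ ()) , λ ρ<j j≤0 → ⊥-elim (<-irrefl refl (<-≤-trans ρ<j j≤0))
rkFrom-largest σ (suc N) = if-does (rkOk? σ (suc N)) (LargestRkOk σ (suc N))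
  (λ ok → ≤-refl , ok , λ ρ<j j≤1+N → ⊥-elim (<-irrefl refl (<-≤-trans ρ<j j≤1+N)))
  (λ ¬ok → let ρ≤N , ok , maximal = rkFrom-largest σ N in m≤n⇒m≤1+n ρ≤N , ok , λ ρ<j j≤1+N →
    [ (λ j≤N → maximal ρ<j (s≤s⁻¹ j≤N)) , (λ { refl → ¬ok }) ]′ (m≤n⇒m<n∨m≡n j≤1+N))

rkOk⇔≤prefMin : ∀ {n} (σ : Permutation′ n) {k} → k ≤ n → RkOk σ k ⇔ k ≤ prefMin σ k
rkOk⇔≤prefMin {n} σ {k} k≤n = mk⇔ to from
  where
  to : RkOk σ k → k ≤ prefMin σ k
  to ok = subst (k ≤_) (sym (prefMin≡prefixMin σ k)) (≤prefixMin k k≤n λ {i} i<k →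
    let i<n = <-≤-trans i<k k≤n in
    subst (k ≤_) (sym (val-fromℕ< σ i<n)) (ok (fromℕ< i<n) (subst (_< k) (sym (FP.toℕ-fromℕ< i<n)) i<k)))
  from : k ≤ prefMin σ k → RkOk σ k
  from k≤min i i<k = subst (k ≤_) (val-toℕ σ i)
    (≤-trans (subst (k ≤_) (prefMin≡prefixMin σ k) k≤min) (prefixMin≤ i<k))

w-nonincreasing : ∀ {n} (σ : Permutation′ n) {r} → r ≤ n → w σ (suc r) ≤ w σ r
w-nonincreasing {n} σ {r} r≤n with m≤n⇒m<n∨m≡n r≤n
... | inj₁ r<n  = subst₂ _≤_ (sym (w≡prefMin σ r<n)) (sym (w≡prefMin σ r≤n)) (m⊓n≤m (prefMin σ r) (val σ r))
... | inj₂ refl = subst (_≤ w σ r) (sym (w-last σ)) z≤n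

[n∸[[n∸m]∸m]]/2≡m : ∀ n m → m + m ≤ n → (n ∸ ((n ∸ m) ∸ m)) / 2 ≡ m
[n∸[[n∸m]∸m]]/2≡m n m m+m≤n = begin
  (n ∸ ((n ∸ m) ∸ m)) / 2  ≡⟨ cong (λ x → (n ∸ x) / 2) (∸-+-assoc n m m) ⟩
  (n ∸ (n ∸ (m + m))) / 2  ≡⟨ cong (_/ 2) (m∸[m∸n]≡n m+m≤n) ⟩
  (m + m) / 2              ≡⟨ cong (_/ 2) (trans (cong (m +_) (sym (+-identityʳ m))) (*-comm 2 m)) ⟩
  m * 2 / 2                ≡⟨ m*n/n≡m m 2 ⟩
  m                        ∎
  where open ≡-Reasoning

rk≡[n∸he]/2 : ∀ {n} (σ : Permutation′ n) → 1 ≤ n → rk σ ≡ (n ∸ he n (Ψ σ)) / 2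
rk≡[n∸he]/2 {n} σ 1≤n = begin
  ρ                                 ≡⟨ [n∸[[n∸m]∸m]]/2≡m n ρ ρ+ρ≤n ⟨
  (n ∸ ((n ∸ ρ) ∸ ρ)) / 2           ≡⟨ cong (λ h → (n ∸ h) / 2) he≡ ⟨
  (n ∸ he n (Ψ σ)) / 2              ∎
  where
  open ≡-Reasoning
  ρ = rk σ
  largest = rkFrom-largest σ n
  ρ≤n = proj₁ largest
  ok = proj₁ (proj₂ largest)
  first = fromℕ< 1≤n
  ρ<n : ρ < n
  ρ<n = ≤∧≢⇒< ρ≤n λ ρ≡n → <⇒≱ (FP.toℕ<n (σ ⟨$⟩ʳ first))
    (subst (λ k → RkOk σ k) ρ≡n ok first (subst (_< n) (sym (FP.toℕ-fromℕ< 1≤n)) 1≤n))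
  ρ≤min : ρ ≤ prefMin σ ρ
  ρ≤min = Equivalence.to (rkOk⇔≤prefMin σ ρ≤n) ok
  above : ρ ≤ w σ ρ
  above = subst (ρ ≤_) (sym (w≡prefMin σ ρ≤n)) ρ≤min
  below : w σ (suc ρ) ≤ ρ
  below = subst (_≤ ρ) (sym (w≡prefMin σ ρ<n))
    (s≤s⁻¹ (≰⇒> (proj₂ (proj₂ largest) ≤-refl ρ<n ∘ Equivalence.from (rkOk⇔≤prefMin σ ρ<n))))
  ρ+ρ≤n : ρ + ρ ≤ n
  ρ+ρ≤n = m≤o∸n⇒m+n≤o ρ ρ≤n (injective⇒≤∸ (val σ)
    (λ i<ρ → ≤-trans (subst (ρ ≤_) (prefMin≡prefixMin σ ρ) ρ≤min) (prefixMin≤ i<ρ) , val-bounded σ (<-≤-trans i<ρ ρ≤n))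
    (λ i<ρ j<ρ → val-injective σ (<-≤-trans i<ρ ρ≤n) (<-≤-trans j<ρ ρ≤n)))
  counts = take-ψ-counts (w-nonincreasing σ) (w≡prefMin σ z≤n) (w-last σ) ρ<n below above
  he≡ : he n (Ψ σ) ≡ (n ∸ ρ) ∸ ρ
  he≡ = cong₂ _∸_ (trans (cong (numU ∘ take n) (Ψ≡ψ σ)) (proj₁ counts))
                  (trans (cong (numD ∘ take n) (Ψ≡ψ σ)) (proj₂ counts))

Ψ-isDyckPath : ∀ {n} (σ : Permutation′ n) → Avoids132 σ → IsDyckPath n (Ψ σ)
Ψ-isDyckPath σ av with t , refl , agree ← decompose (avoids132⇒perm132 σ av) =
  subst (IsDyckPath (size t)) (sym (Ψ≡word σ t refl agree)) (word-isDyckPath t)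

Ψ-injective : ∀ {n} (σ τ : Permutation′ n) → Avoids132 σ → Avoids132 τ →
  Ψ σ ≡ Ψ τ → ∀ i → σ ⟨$⟩ʳ i ≡ τ ⟨$⟩ʳ i
Ψ-injective σ τ avσ avτ Ψσ≡Ψτ i
  with tσ , |tσ| , agreeσ ← decompose (avoids132⇒perm132 σ avσ)
     | tτ , |tτ| , agreeτ ← decompose (avoids132⇒perm132 τ avτ) = FP.toℕ-injective (begin
  toℕ (σ ⟨$⟩ʳ i)   ≡⟨ val-toℕ σ i ⟨
  val σ (toℕ i)    ≡⟨ agreeσ (FP.toℕ<n i) ⟩
  perm tσ (toℕ i)  ≡⟨ cong (λ t → perm t (toℕ i)) (word-injective {tσ} {tτ} (begin
    word tσ          ≡⟨ Ψ≡word σ tσ |tσ| agreeσ ⟨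
    Ψ σ              ≡⟨ Ψσ≡Ψτ ⟩
    Ψ τ              ≡⟨ Ψ≡word τ tτ |tτ| agreeτ ⟩
    word tτ          ∎)) ⟩
  perm tτ (toℕ i)  ≡⟨ agreeτ (FP.toℕ<n i) ⟨
  val τ (toℕ i)    ≡⟨ val-toℕ τ i ⟩
  toℕ (τ ⟨$⟩ʳ i)   ∎)
  where open ≡-Reasoning

Ψ-surjective : ∀ {n D} → IsDyckPath n D → ∃[ σ ] (Avoids132 {n} σ × Ψ σ ≡ D)
Ψ-surjective dyck with t , refl , refl ← word-surjective dyck
  with σ , av , agree ← perm132⇒permutation (perm-perm132 t) = σ , av , Ψ≡word σ t refl agree

Ψ-statistics : ∀ {n} (σ : Permutation′ n) → 1 ≤ n → Avoids132 σ →
  fp σ ≡ ct (Ψ σ) × exc σ ≡ rt (Ψ σ) × rk σ ≡ (n ∸ he n (Ψ σ)) / 2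
Ψ-statistics σ 1≤n av with t , |t| , agree ← decompose (avoids132⇒perm132 σ av) =
  trans (fp≡ct σ t |t| agree) (cong ct (sym (Ψ≡word σ t |t| agree))) ,
  trans (exc≡rt σ t |t| agree) (cong rt (sym (Ψ≡word σ t |t| agree))) ,
  rk≡[n∸he]/2 σ 1≤n

proposition2 : (n : ℕ) → 1 ≤ n →
    ((σ : Permutation′ n) → Avoids132 σ → IsDyckPath n (Ψ σ))
    × ((σ τ : Permutation′ n) → Avoids132 σ → Avoids132 τ →
        Ψ σ ≡ Ψ τ → ∀ i → σ ⟨$⟩ʳ i ≡ τ ⟨$⟩ʳ i)
    × ((D : List Step) → IsDyckPath n D →
        ∃[ σ ] (Avoids132 {n} σ × Ψ σ ≡ D))
    × ((σ : Permutation′ n) → Avoids132 σ →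
        fp σ ≡ ct (Ψ σ)
        × exc σ ≡ rt (Ψ σ)
        × rk σ ≡ (n ∸ he n (Ψ σ)) / 2)
proposition2 n 1≤n = Ψ-isDyckPath , Ψ-injective , (λ _ → Ψ-surjective) , (λ σ → Ψ-statistics σ 1≤n)
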